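{- Fix $n\ge1$ and an integer $0\le\alpha<2^n$ whose $n$-bit binary representation (most significant bit first, leading zeros allowed) is $\sigma=\sigma_1\cdots\sigma_m$, with $\sigma_i$ the maximal runs of equal bits, $\sigma_i=a_i^{L_i}$ with $a_i\in\{0,1\}$. Let $S$, $T$, $X_i$, $Y_i$ and the carries $c_i$ be as in the context, and write $L=L_i$. (a) The covariance matrix of the trivial-to-non-trivial distribution of $(X_i,Y_i)$ (i.e. the conditional law given $c_{i+1}=a_i$ and $c_i=a_i$) is $\begin{pmatrix}\frac{L}{4}&\frac L4\\ \frac L4&\frac L4\end{pmatrix}$. (b) The covariance matrix of the non-trivial-to-non-trivial distribution of $(X_i,Y_i)$ (i.e. the conditional law given $c_{i+1}\ne a_i$ and $c_i=a_i$) is $\begin{pmatrix}c&d\\ d&c\end{pmatrix}$, where $c=\frac{L}{4}\left(1+\frac{1}{2^{L}-1}\right)-\frac{L^2}{4}\left(1+\frac{1}{2^{L}-1}\right)\frac{1}{2^{L}-1}$ and $d=\frac{L}{4}\left(1+\frac{1}{2^{L}-1}\right)+\frac{L^2}{4}\left(1+\frac{1}{2^{L}-1}\right)\frac{1}{2^{L}-1}-1$. (Each statement is for those $i$ for which the conditioning event has positive probability.)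
   Context: $S$ is uniform on $\{0,\dots,2^n-1\}$ and $T=S+\alpha\bmod 2^n$, both written as $n$-bit strings and cut into consecutive pieces $S=S_1\cdots S_m$, $T=T_1\cdots T_m$ with $|S_i|=|T_i|=L_i$; $X_i=wt(S_i)$, $Y_i=wt(T_i)$ (Hamming weights). Carries: $c_{m+1}=0$; for each $i$, viewing $S_i$, $\sigma_i$ as integers in $[0,2^{L_i})$, $T_i\equiv S_i+\sigma_i+c_{i+1}\pmod{2^{L_i}}$ and $c_i=1$ iff $S_i+\sigma_i+c_{i+1}\ge 2^{L_i}$ ($c_i$ is the carry from block $i$ to block $i-1$). The carry into block $i$ is called trivial if $c_{i+1}=a_i$ (then block $i$ of $T$ equals block $i$ of $S$) and non-trivial otherwise; the carry out $c_i$ is called non-trivial (for the next block $i-1$, whose bit is $1-a_i$) if $c_i=a_i$. -}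

module Defs where

open import Data.Bool using (Bool; true; false; if_then_else_; _∧_; not)
open import Data.Bool.Properties using () renaming (_≟_ to _≟ᵇ_)
open import Data.Nat as ℕ using (ℕ; zero; suc; _≤?_; _≤_; _<_; NonZero; >-nonZero)
open import Data.Nat.Properties using (m^n≢0; m^n>0; m<n⇒0<n∸m; *-monoʳ-≤)
open import Data.Nat.DivMod using (_%_; _/_)
open import Data.Integer using (+_)
open import Data.Rational using (ℚ; 0ℚ; 1ℚ) renaming (_/_ to _÷ℚ_; _*_ to _*ℚ_; _-_ to _-ℚ_; _+_ to _+ℚ_)
open import Data.Nat.ListAction using (sum)
open import Data.List using (List; []; _∷_; _++_; [_]; take; drop; map; length; filterᵇ; upTo; zipWith; lookup)
open import Data.Fin using (Fin; toℕ)
open import Data.Product using (_×_; _,_; proj₁; proj₂)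
open import Relation.Nullary using (does)

bit : Bool → ℕ
bit false = 0
bit true  = 1

-- n-bit binary representation of x (MSB first, leading zeros allowed);
-- meaningful for x < 2^n.
toBits : ℕ → ℕ → List Bool
toBits zero    x = []
toBits (suc n) x = toBits n (x / 2) ++ [ does (x % 2 ℕ.≟ 1) ]

val : List Bool → ℕ
val []       = 0
val (b ∷ bs) = bit b ℕ.* 2 ℕ.^ length bs ℕ.+ val bs

wt : List Bool → ℕ
wt bs = sum (map bit bs)

-- maximal runs of equal bits: list of (a_i , L_i), L_i ≥ 1
runs : List Bool → List (Bool × ℕ)
runs []       = []
runs (b ∷ bs) = push (runs bs)
  where
  push : List (Bool × ℕ) → List (Bool × ℕ)
  push []              = (b , 1) ∷ []
  push ((a , k) ∷ rs) = if does (b ≟ᵇ a) then (a , suc k) ∷ rs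
                                          else (b , 1) ∷ (a , k) ∷ rs

cut : List ℕ → List Bool → List (List Bool)
cut []       bs = []
cut (L ∷ Ls) bs = take L bs ∷ cut Ls (drop L bs)

σ : ℕ → ℕ → List Bool
σ n α = toBits n α

rs : ℕ → ℕ → List (Bool × ℕ)
rs n α = runs (σ n α)

lens : ℕ → ℕ → List ℕ
lens n α = map proj₂ (rs n α)

-- S as n-bit string, and T = S + α mod 2^n as n-bit string
Sbits : ℕ → ℕ → ℕ → List Bool
Sbits n α s = toBits n s

Tbits : ℕ → ℕ → ℕ → List Bool
Tbits n α s = toBits n (_%_ (s ℕ.+ α) (2 ℕ.^ n) {{m^n≢0 2 n}})

-- blocks (S_i , σ_i , L_i), i = 1..m
blocks : ℕ → ℕ → ℕ → List (List Bool × List Bool × ℕ)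
blocks n α s = zipWith (λ u vL → (u , vL))
                 (cut (lens n α) (Sbits n α s))
                 (zipWith _,_ (cut (lens n α) (σ n α)) (lens n α))

-- carry out of the first block of a suffix list of blocks;
-- on the empty list this is c_{m+1} = 0.
carryOut : List (List Bool × List Bool × ℕ) → Bool
carryOut []                    = false
carryOut ((u , v , L) ∷ rest) =
  does (2 ℕ.^ L ≤? val u ℕ.+ val v ℕ.+ bit (carryOut rest))

-- for a 0-based block index k (block i = k+1):
--   cOutOf k = c_i      (carry from block i to block i-1)
--   cInOf  k = c_{i+1}  (carry into block i)
cOutOf : ℕ → ℕ → ℕ → ℕ → Bool
cOutOf n α k s = carryOut (drop k (blocks n α s))

cInOf : ℕ → ℕ → ℕ → ℕ → Bool
cInOf n α k s = carryOut (drop (suc k) (blocks n α s))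

-- piece number k (0-based) of a bit string cut along the runs of σ
piece : ℕ → ℕ → ℕ → List Bool → List Bool
piece n α k bs = take (sum (take (suc k) (lens n α)) ℕ.∸ sum (take k (lens n α)))
                      (drop (sum (take k (lens n α))) bs)

Xof : ℕ → ℕ → ℕ → ℕ → ℕ
Xof n α k s = wt (piece n α k (Sbits n α s))

Yof : ℕ → ℕ → ℕ → ℕ → ℕ
Yof n α k s = wt (piece n α k (Tbits n α s))

-- mean of a list of naturals (uniform distribution on the list entries)
mean : List ℕ → ℚ
mean []       = 0ℚ
mean (x ∷ xs) = (+ sum (x ∷ xs)) ÷ℚ length (x ∷ xs)

cov : List ℕ → (ℕ → ℕ) → (ℕ → ℕ) → ℚ
cov xs f g = mean (map (λ s → f s ℕ.* g s) xs) -ℚ mean (map f xs) *ℚ mean (map g xs)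

XY : ℕ → ℕ → ℕ → Fin 2 → ℕ → ℕ
XY n α k Fin.zero     s = Xof n α k s
XY n α k (Fin.suc _)  s = Yof n α k s

covMatrix : ℕ → ℕ → ℕ → List ℕ → Fin 2 → Fin 2 → ℚ
covMatrix n α k xs j l = cov xs (XY n α k j) (XY n α k l)

trivToNontriv : ℕ → ℕ → ℕ → Bool → List ℕ
trivToNontriv n α k a =
  filterᵇ (λ s → does (cInOf n α k s ≟ᵇ a) ∧ does (cOutOf n α k s ≟ᵇ a)) (upTo (2 ℕ.^ n))

nontrivToNontriv : ℕ → ℕ → ℕ → Bool → List ℕ
nontrivToNontriv n α k a =
  filterᵇ (λ s → not (does (cInOf n α k s ≟ᵇ a)) ∧ does (cOutOf n α k s ≟ᵇ a)) (upTo (2 ℕ.^ n))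

-- 1 / (2^L - 1)  (L ≥ 1; value at L = 0 is irrelevant and set to 0)
inv2^L-1 : ℕ → ℚ
inv2^L-1 zero    = 0ℚ
inv2^L-1 (suc k) = _÷ℚ_ (+ 1) (2 ℕ.^ suc k ℕ.∸ 1) {{>-nonZero (m<n⇒0<n∸m lt)}}
  where
  lt : 1 < 2 ℕ.^ suc k
  lt = *-monoʳ-≤ 2 (m^n>0 2 k)

matA : ℕ → Fin 2 → Fin 2 → ℚ
matA L _ _ = (+ L) ÷ℚ 4

cConst : ℕ → ℚ
cConst L = ((+ L) ÷ℚ 4) *ℚ (1ℚ +ℚ inv2^L-1 L)
           -ℚ ((+ (L ℕ.* L)) ÷ℚ 4) *ℚ (1ℚ +ℚ inv2^L-1 L) *ℚ inv2^L-1 L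

dConst : ℕ → ℚ
dConst L = ((+ L) ÷ℚ 4) *ℚ (1ℚ +ℚ inv2^L-1 L)
           +ℚ ((+ (L ℕ.* L)) ÷ℚ 4) *ℚ (1ℚ +ℚ inv2^L-1 L) *ℚ inv2^L-1 L
           -ℚ 1ℚ

matB : ℕ → Fin 2 → Fin 2 → ℚ
matB L Fin.zero    Fin.zero    = cConst L
matB L (Fin.suc _) (Fin.suc _) = cConst L
matB L _           _           = dConst L

-- Split the bits of S into those above, inside and below block i, of lengths P, L and R. The
-- carry c_{i+1} into the block depends only on the R low bits, the block value u of S is
-- uniform and independent of them, and T_i = u + σ_i + c_{i+1} mod 2^L, where σ_i is 0 or
-- 2^L - 1. Conditioning on the two carries therefore leaves u uniform on a set of block
-- values. In the trivial-to-non-trivial case this is all of [0, 2^L) and T_i = S_i, so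
-- X = Y and the covariance is the variance L/4 of wt u. In the non-trivial-to-non-trivial
-- case it has 2^L - 1 elements and (X, Y) = (wt v, wt (v+1)) for v < 2^L - 1 (or the
-- swapped pair when a_i = 1). The entries follow from the closed forms, proved by
-- induction on L,
--   Σ wt u = L 2^L / 2,   Σ (wt u)² = L (L+1) 2^L / 4,
--   Σ_{v < 2^L - 1} wt v · wt (v+1) = (L² + L) 2^L / 4 + 1 - 2^L.
module Submission where

open import Defs
open import Data.Nat using (ℕ; _≤_; _<_; _^_)
open import Data.Fin using (Fin; toℕ)
open import Data.List using (List; []; length; lookup)
open import Data.Product using (_×_; proj₁; proj₂)
open import Relation.Binary.PropositionalEquality using (_≡_; _≢_)

open import Function using (_∘_)
import Data.Fin as Fin
open import Data.Bool using (Bool; true; false; if_then_else_; _∧_; not)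
open import Data.Bool.Properties using () renaming (_≟_ to _≟ᵇ_)
open import Data.Nat using (zero; suc; pred; _+_; _*_; _∸_; z≤n; s≤s; NonZero; >-nonZero; _≤?_; _≟_)
open import Data.Nat.Properties
open import Data.Nat.DivMod
open import Data.Nat.Divisibility using (divides; n∣m*n)
open import Data.Nat.ListAction using (sum)
open import Data.Nat.ListAction.Properties using (sum-++)
open import Data.Nat.Tactic.RingSolver using (solve-∀)
open import Data.List using (_∷_; _++_; [_]; map; replicate; take; drop; filterᵇ; upTo; applyUpTo; zipWith)
open import Data.List.Properties
  using (++-assoc; ++-identityʳ; map-++; length-++; length-map; length-replicate; length-drop; take++drop≡id; drop-drop)
open import Data.List.Relation.Unary.All using (All; []; _∷_)
import Data.List.Relation.Unary.All as All
open import Data.List.Membership.Propositional.Properties using (∈-lookup)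
open import Data.Product using (_,_; Σ-syntax)
open import Data.Empty using (⊥-elim)
open import Relation.Binary.PropositionalEquality
  using (refl; sym; trans; cong; cong₂; subst; subst₂; module ≡-Reasoning)
import Data.Integer as ℤ
import Data.Integer.Properties as ℤ
open import Data.Rational using (ℚ; 1ℚ; toℚᵘ) renaming (_/_ to _÷ℚ_; _*_ to _*ℚ_; _-_ to _-ℚ_; _+_ to _+ℚ_)
open import Data.Rational.Properties using (toℚᵘ-injective; toℚᵘ-fromℚᵘ; toℚᵘ-homo-+; toℚᵘ-homo-*)
open import Data.Rational.Unnormalised using (mkℚᵘ; *≡*)
import Data.Rational.Unnormalised as ℚᵘ
import Data.Rational.Unnormalised.Properties as ℚᵘ
open import Data.Rational.Solver renaming (module +-*-Solver to ℚ-Solver)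
open import Relation.Nullary using (Dec; yes; no; does)
open import Relation.Nullary.Decidable using (does-⇔; dec-true; dec-false)
open import Function.Bundles using (_⇔_; mk⇔)

cong₃ : ∀ {A B C D : Set} (f : A → B → C → D) {x x′ y y′ z z′} → x ≡ x′ → y ≡ y′ → z ≡ z′ → f x y z ≡ f x′ y′ z′
cong₃ f refl refl refl = refl

2^-nonZero : ∀ n → NonZero (2 ^ n)
2^-nonZero n = m^n≢0 2 n

-- Finite sums

∑ : ℕ → (ℕ → ℕ) → ℕ
∑ zero    f = 0
∑ (suc n) f = f 0 + ∑ n (f ∘ suc)

∑-cong-< : ∀ n {f g : ℕ → ℕ} → (∀ i → i < n → f i ≡ g i) → ∑ n f ≡ ∑ n g
∑-cong-< zero    f≡g = refl
∑-cong-< (suc n) f≡g = cong₂ _+_ (f≡g 0 (s≤s z≤n)) (∑-cong-< n (λ i i<n → f≡g (suc i) (s≤s i<n)))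

∑-cong : ∀ n {f g : ℕ → ℕ} → (∀ i → f i ≡ g i) → ∑ n f ≡ ∑ n g
∑-cong n f≡g = ∑-cong-< n (λ i _ → f≡g i)

sum-map-applyUpTo : ∀ (f g : ℕ → ℕ) n → sum (map f (applyUpTo g n)) ≡ ∑ n (f ∘ g)
sum-map-applyUpTo f g zero    = refl
sum-map-applyUpTo f g (suc n) = cong (f (g 0) +_) (sum-map-applyUpTo f (g ∘ suc) n)

sum-map-upTo : ∀ (f : ℕ → ℕ) n → sum (map f (upTo n)) ≡ ∑ n f
sum-map-upTo f = sum-map-applyUpTo f (λ i → i)

∑-split : ∀ m n (f : ℕ → ℕ) → ∑ (m + n) f ≡ ∑ m f + ∑ n (λ j → f (m + j))
∑-split zero    n f = refl
∑-split (suc m) n f = trans (cong (f 0 +_) (∑-split m n (f ∘ suc))) (sym (+-assoc (f 0) _ _))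

∑-last : ∀ n (f : ℕ → ℕ) → ∑ (suc n) f ≡ ∑ n f + f n
∑-last n f = begin
  ∑ (suc n) f              ≡⟨ cong (λ k → ∑ k f) (+-comm 1 n) ⟩
  ∑ (n + 1) f              ≡⟨ ∑-split n 1 f ⟩
  ∑ n f + (f (n + 0) + 0)  ≡⟨ cong (∑ n f +_) (trans (+-identityʳ _) (cong f (+-identityʳ n))) ⟩
  ∑ n f + f n              ∎
  where open ≡-Reasoning

∑-divmod : ∀ a b (f : ℕ → ℕ) → ∑ (a * b) f ≡ ∑ a (λ q → ∑ b (λ r → f (q * b + r)))
∑-divmod zero    b f = refl
∑-divmod (suc a) b f = trans (∑-split b (a * b) f) (cong (∑ b f +_) (trans (∑-divmod a b (λ j → f (b + j)))
  (∑-cong a (λ q → ∑-cong b (λ r → cong f (sym (+-assoc b (q * b) r)))))))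

∑-*ˡ : ∀ n c (f : ℕ → ℕ) → ∑ n (λ i → c * f i) ≡ c * ∑ n f
∑-*ˡ zero    c f = sym (*-zeroʳ c)
∑-*ˡ (suc n) c f = trans (cong (c * f 0 +_) (∑-*ˡ n c (f ∘ suc))) (sym (*-distribˡ-+ c (f 0) _))

∑-*ʳ : ∀ n c (f : ℕ → ℕ) → ∑ n (λ i → f i * c) ≡ ∑ n f * c
∑-*ʳ n c f = trans (∑-cong n (λ i → *-comm (f i) c)) (trans (∑-*ˡ n c f) (*-comm c _))

∑-const : ∀ n c → ∑ n (λ _ → c) ≡ n * c
∑-const zero    c = refl
∑-const (suc n) c = cong (c +_) (∑-const n c)

∑-count : ∀ n → ∑ n (λ _ → 1) ≡ n
∑-count n = trans (∑-const n 1) (*-identityʳ n)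

∑-distrib-+ : ∀ n (f g : ℕ → ℕ) → ∑ n (λ i → f i + g i) ≡ ∑ n f + ∑ n g
∑-distrib-+ zero    f g = refl
∑-distrib-+ (suc n) f g =
  trans (cong (f 0 + g 0 +_) (∑-distrib-+ n (f ∘ suc) (g ∘ suc))) (+-interchange (f 0) (g 0) _ _)
  where
  +-interchange : ∀ a b c d → a + b + (c + d) ≡ a + c + (b + d)
  +-interchange = solve-∀

∑-indicator : ∀ n (c : ℕ → Bool) x → ∑ n (λ i → if c i then x else 0) ≡ ∑ n (λ i → if c i then 1 else 0) * x
∑-indicator n c x = trans (∑-cong n (λ i → if-* (c i))) (∑-*ʳ n x (λ i → if c i then 1 else 0))
  where
  if-* : ∀ b → (if b then x else 0) ≡ (if b then 1 else 0) * x
  if-* true  = sym (+-identityʳ x)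
  if-* false = refl

sum-filterᵇ : ∀ (p : ℕ → Bool) (F : ℕ → ℕ) xs →
  sum (map F (filterᵇ p xs)) ≡ sum (map (λ s → if p s then F s else 0) xs)
sum-filterᵇ p F []       = refl
sum-filterᵇ p F (x ∷ xs) with p x
... | true  = cong (F x +_) (sum-filterᵇ p F xs)
... | false = sum-filterᵇ p F xs

length-filterᵇ : ∀ (p : ℕ → Bool) xs → length (filterᵇ p xs) ≡ sum (map (λ s → if p s then 1 else 0) xs)
length-filterᵇ p []       = refl
length-filterᵇ p (x ∷ xs) with p x
... | true  = cong suc (length-filterᵇ p xs)
... | false = length-filterᵇ p xs

-- Binary representations and Hamming weights

length-toBits : ∀ n x → length (toBits n x) ≡ n
length-toBits zero    x = refl
length-toBits (suc n) x = trans (length-++ (toBits n (x / 2))) (trans (cong (_+ 1) (length-toBits n (x / 2))) (+-comm n 1))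

bit-%2 : ∀ x → bit (does (x % 2 ≟ 1)) ≡ x % 2
bit-%2 x with x % 2 | m%n<n x 2
... | 0           | _               = refl
... | 1           | _               = refl
... | suc (suc _) | s≤s (s≤s ())

module _ (n : ℕ) where
  private instance
    _ = 2^-nonZero n
    _ = 2^-nonZero (suc n)
    _ = m*n≢0 (2 ^ n) 2

  [m/2]%2^n≡m%2^[1+n]/2 : ∀ x → x / 2 % 2 ^ n ≡ x % 2 ^ suc n / 2
  [m/2]%2^n≡m%2^[1+n]/2 x = begin
    x / 2 % 2 ^ n         ≡⟨ m%[n*o]/o≡m/o%n x (2 ^ n) 2 ⟨
    x % (2 ^ n * 2) / 2   ≡⟨ /-congˡ (%-congʳ (*-comm (2 ^ n) 2)) ⟩
    x % 2 ^ suc n / 2     ∎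
    where open ≡-Reasoning

  m%2^[1+n]%2≡m%2 : ∀ x → x % 2 ^ suc n % 2 ≡ x % 2
  m%2^[1+n]%2≡m%2 x = m∣n⇒o%n%m≡o%m 2 (2 ^ suc n) x (divides (2 ^ n) (*-comm 2 (2 ^ n)))

toBits-cong : ∀ n x y → (x % 2 ^ n) {{2^-nonZero n}} ≡ (y % 2 ^ n) {{2^-nonZero n}} → toBits n x ≡ toBits n y
toBits-cong zero    x y _   = refl
toBits-cong (suc n) x y x≡y = cong₂ (λ u v → u ++ [ does (v ≟ 1) ]) (toBits-cong n (x / 2) (y / 2) high) low
  where
  instance _ = 2^-nonZero n
  instance _ = 2^-nonZero (suc n)
  high : x / 2 % 2 ^ n ≡ y / 2 % 2 ^ n
  high = trans ([m/2]%2^n≡m%2^[1+n]/2 n x) (trans (cong (_/ 2) x≡y) (sym ([m/2]%2^n≡m%2^[1+n]/2 n y)))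
  low : x % 2 ≡ y % 2
  low = trans (sym (m%2^[1+n]%2≡m%2 n x)) (trans (cong (_% 2) x≡y) (m%2^[1+n]%2≡m%2 n y))

toBits-% : ∀ n x → toBits n x ≡ toBits n ((x % 2 ^ n) {{2^-nonZero n}})
toBits-% n x = toBits-cong n x _ (sym (m%n%n≡m%n x (2 ^ n) {{2^-nonZero n}}))

toBits-+ : ∀ m n x → toBits (m + n) x ≡ toBits n ((x / 2 ^ m) {{2^-nonZero m}}) ++ toBits m x
toBits-+ zero    n x = sym (trans (++-identityʳ _) (cong (toBits n) (n/1≡n x)))
toBits-+ (suc m) n x = begin
  toBits (m + n) (x / 2) ++ [ b ]                          ≡⟨ cong (_++ [ b ]) (toBits-+ m n (x / 2)) ⟩
  (toBits n (x / 2 / 2 ^ m) ++ toBits m (x / 2)) ++ [ b ]  ≡⟨ ++-assoc (toBits n _) (toBits m (x / 2)) [ b ] ⟩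
  toBits n (x / 2 / 2 ^ m) ++ toBits (suc m) x             ≡⟨ cong (λ y → toBits n y ++ toBits (suc m) x) (m/n/o≡m/[n*o] x 2 (2 ^ m)) ⟩
  toBits n (x / 2 ^ suc m) ++ toBits (suc m) x             ∎
  where
  open ≡-Reasoning
  instance _ = 2^-nonZero m
  instance _ = 2^-nonZero (suc m)
  b = does (x % 2 ≟ 1)

val-++ : ∀ xs ys → val (xs ++ ys) ≡ val xs * 2 ^ length ys + val ys
val-++ []       ys = refl
val-++ (b ∷ xs) ys = begin
  bit b * 2 ^ length (xs ++ ys) + val (xs ++ ys)
    ≡⟨ cong₂ (λ p v → bit b * p + v) (trans (cong (2 ^_) (length-++ xs)) (^-distribˡ-+-* 2 (length xs) (length ys))) (val-++ xs ys) ⟩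
  bit b * (2 ^ length xs * 2 ^ length ys) + (val xs * 2 ^ length ys + val ys)
    ≡⟨ regroup (bit b) (2 ^ length xs) (2 ^ length ys) (val xs) (val ys) ⟩
  (bit b * 2 ^ length xs + val xs) * 2 ^ length ys + val ys ∎
  where
  open ≡-Reasoning
  regroup : ∀ c p q v w → c * (p * q) + (v * q + w) ≡ (c * p + v) * q + w
  regroup = solve-∀

val-toBits : ∀ n x → val (toBits n x) ≡ (x % 2 ^ n) {{2^-nonZero n}}
val-toBits zero    x = sym (n%1≡0 x)
val-toBits (suc n) x = begin
  val (toBits n (x / 2) ++ [ b ])          ≡⟨ val-++ (toBits n (x / 2)) [ b ] ⟩
  val (toBits n (x / 2)) * 2 + (bit b * 1 + 0)
    ≡⟨ cong₂ (λ u v → u * 2 + v) (trans (val-toBits n (x / 2)) ([m/2]%2^n≡m%2^[1+n]/2 n x))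
                                   (trans (+-identityʳ _) (trans (*-identityʳ _) (trans (bit-%2 x) (sym (m%2^[1+n]%2≡m%2 n x))))) ⟩
  y / 2 * 2 + y % 2                         ≡⟨ +-comm (y / 2 * 2) (y % 2) ⟩
  y % 2 + y / 2 * 2                         ≡⟨ m≡m%n+[m/n]*n y 2 ⟨
  y                                         ∎
  where
  open ≡-Reasoning
  instance _ = 2^-nonZero n
  instance _ = 2^-nonZero (suc n)
  b = does (x % 2 ≟ 1)
  y = x % 2 ^ suc n

1*p+p≡2*p : ∀ p → 1 * p + p ≡ 2 * p
1*p+p≡2*p = solve-∀

val<2^length : ∀ xs → val xs < 2 ^ length xs
val<2^length []       = s≤s z≤n
val<2^length (b ∷ xs) = begin-strict
  bit b * 2 ^ length xs + val xs      <⟨ +-monoʳ-< (bit b * 2 ^ length xs) (val<2^length xs) ⟩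
  bit b * 2 ^ length xs + 2 ^ length xs ≤⟨ +-monoˡ-≤ (2 ^ length xs) (*-monoˡ-≤ (2 ^ length xs) (bit≤1 b)) ⟩
  1 * 2 ^ length xs + 2 ^ length xs   ≡⟨ 1*p+p≡2*p (2 ^ length xs) ⟩
  2 ^ suc (length xs)                 ∎
  where
  open ≤-Reasoning
  bit≤1 : ∀ b → bit b ≤ 1
  bit≤1 false = z≤n
  bit≤1 true  = s≤s z≤n

val-replicate-false : ∀ n → val (replicate n false) ≡ 0
val-replicate-false zero    = refl
val-replicate-false (suc n) = val-replicate-false n

val-replicate-true : ∀ n → val (replicate n true) + 1 ≡ 2 ^ n
val-replicate-true zero    = refl
val-replicate-true (suc n) = begin
  1 * 2 ^ length (replicate n true) + val (replicate n true) + 1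
    ≡⟨ cong (λ k → 1 * 2 ^ k + val (replicate n true) + 1) (length-replicate n) ⟩
  1 * 2 ^ n + val (replicate n true) + 1   ≡⟨ +-assoc (1 * 2 ^ n) _ 1 ⟩
  1 * 2 ^ n + (val (replicate n true) + 1) ≡⟨ cong (1 * 2 ^ n +_) (val-replicate-true n) ⟩
  1 * 2 ^ n + 2 ^ n                        ≡⟨ 1*p+p≡2*p (2 ^ n) ⟩
  2 ^ suc n                                ∎
  where open ≡-Reasoning

wt-++ : ∀ xs ys → wt (xs ++ ys) ≡ wt xs + wt ys
wt-++ xs ys = trans (cong sum (map-++ bit xs ys)) (sum-++ (map bit xs) (map bit ys))

module _ {m : ℕ} .{{_ : NonZero m}} where

  [q*m+r]/m≡q : ∀ q r → r < m → (q * m + r) / m ≡ q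
  [q*m+r]/m≡q q r r<m = begin
    (q * m + r) / m   ≡⟨ cong (_/ m) (+-comm (q * m) r) ⟩
    (r + q * m) / m   ≡⟨ +-distrib-/-∣ʳ r (n∣m*n q) ⟩
    r / m + q * m / m ≡⟨ cong₂ _+_ (m<n⇒m/n≡0 r<m) (m*n/n≡m q m) ⟩
    q                 ∎
    where open ≡-Reasoning

  [q*m+r]%m≡r : ∀ q r → r < m → (q * m + r) % m ≡ r
  [q*m+r]%m≡r q r r<m = trans (cong (_% m) (+-comm (q * m) r)) (trans ([m+kn]%n≡m%n r q m) (m<n⇒m%n≡m r<m))

weight : ℕ → ℕ → ℕ
weight L u = wt (toBits L u)

weight-suc : ∀ L q r → r < 2 → weight (suc L) (q * 2 + r) ≡ weight L q + r
weight-suc L q r r<2 = begin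
  wt (toBits L (x / 2) ++ [ does (x % 2 ≟ 1) ])   ≡⟨ wt-++ (toBits L (x / 2)) _ ⟩
  weight L (x / 2) + (bit (does (x % 2 ≟ 1)) + 0)  ≡⟨ cong (weight L (x / 2) +_) (trans (+-identityʳ _) (bit-%2 x)) ⟩
  weight L (x / 2) + x % 2                        ≡⟨ cong₂ _+_ (cong (weight L) ([q*m+r]/m≡q q r r<2)) ([q*m+r]%m≡r q r r<2) ⟩
  weight L q + r                                  ∎
  where
  open ≡-Reasoning
  x = q * 2 + r

weight-0 : ∀ L → weight L 0 ≡ 0
weight-0 zero    = refl
weight-0 (suc L) = trans (weight-suc L 0 0 (s≤s z≤n)) (trans (+-identityʳ _) (weight-0 L))

weight-+2^L : ∀ L v → weight L (v + 2 ^ L) ≡ weight L v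
weight-+2^L L v = cong wt (toBits-cong L _ _ ([m+n]%n≡m%n v (2 ^ L) {{2^-nonZero L}}))

2^L≡1+[2^L-1] : ∀ L → 2 ^ L ≡ suc (2 ^ L ∸ 1)
2^L≡1+[2^L-1] L = sym (m+[n∸m]≡n (m^n>0 2 L))

2^L∸1-nonZero : ∀ {L} → 1 ≤ L → NonZero (2 ^ L ∸ 1)
2^L∸1-nonZero 1≤L = >-nonZero (m<n⇒0<n∸m (^-monoʳ-≤ 2 1≤L))

2^[1+L]-1≡[2^L-1]*2+1 : ∀ L → 2 ^ suc L ∸ 1 ≡ (2 ^ L ∸ 1) * 2 + 1
2^[1+L]-1≡[2^L-1]*2+1 L = trans (cong (λ p → 2 * p ∸ 1) (2^L≡1+[2^L-1] L)) (cong (_∸ 1) (double-suc (2 ^ L ∸ 1)))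
  where
  double-suc : ∀ m → 2 * (1 + m) ≡ 1 + (m * 2 + 1)
  double-suc = solve-∀

weight-2^L-1 : ∀ L → weight L (2 ^ L ∸ 1) ≡ L
weight-2^L-1 zero    = refl
weight-2^L-1 (suc L) = begin
  weight (suc L) (2 ^ suc L ∸ 1)           ≡⟨ cong (weight (suc L)) (2^[1+L]-1≡[2^L-1]*2+1 L) ⟩
  weight (suc L) ((2 ^ L ∸ 1) * 2 + 1)     ≡⟨ weight-suc L _ 1 (s≤s (s≤s z≤n)) ⟩
  weight L (2 ^ L ∸ 1) + 1                 ≡⟨ cong (_+ 1) (weight-2^L-1 L) ⟩
  L + 1                                    ≡⟨ +-comm L 1 ⟩
  suc L                                    ∎
  where open ≡-Reasoning

-- Weight sums over all values of a block

∑w : ℕ → ℕ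
∑w L = ∑ (2 ^ L) (weight L)

∑w² : ℕ → ℕ
∑w² L = ∑ (2 ^ L) (λ u → weight L u * weight L u)

∑ww⁺ : ℕ → ℕ
∑ww⁺ L = ∑ (2 ^ L ∸ 1) (λ v → weight L v * weight L (suc v))

∑-pairs : ∀ n (f : ℕ → ℕ) → ∑ (n * 2) f ≡ ∑ n (λ q → f (q * 2 + 0) + f (q * 2 + 1))
∑-pairs n f = trans (∑-divmod n 2 f) (∑-cong n (λ q → cong (f (q * 2 + 0) +_) (+-identityʳ _)))

∑-weight-2^[1+L] : ∀ L (F : ℕ → ℕ) → ∑ (2 ^ suc L) (F ∘ weight (suc L)) ≡ ∑ (2 ^ L) (λ q → F (weight L q + 0) + F (weight L q + 1))
∑-weight-2^[1+L] L F = trans (cong (λ k → ∑ k (F ∘ weight (suc L))) (*-comm 2 (2 ^ L))) (trans (∑-pairs (2 ^ L) (F ∘ weight (suc L)))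
  (∑-cong (2 ^ L) (λ q → cong₂ (λ x y → F x + F y) (weight-suc L q 0 (s≤s z≤n)) (weight-suc L q 1 (s≤s (s≤s z≤n))))))

∑w-suc : ∀ L → ∑w (suc L) ≡ 2 * ∑w L + 2 ^ L
∑w-suc L = begin
  ∑w (suc L)                                             ≡⟨ ∑-weight-2^[1+L] L (λ x → x) ⟩
  ∑ (2 ^ L) (λ q → weight L q + 0 + (weight L q + 1))    ≡⟨ ∑-cong (2 ^ L) (λ q → x+0+[x+1]≡2x+1 (weight L q)) ⟩
  ∑ (2 ^ L) (λ q → 2 * weight L q + 1)                   ≡⟨ ∑-distrib-+ (2 ^ L) _ _ ⟩
  ∑ (2 ^ L) (λ q → 2 * weight L q) + ∑ (2 ^ L) (λ _ → 1) ≡⟨ cong₂ _+_ (∑-*ˡ (2 ^ L) 2 (weight L)) (∑-count (2 ^ L)) ⟩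
  2 * ∑w L + 2 ^ L                                       ∎
  where
  open ≡-Reasoning
  x+0+[x+1]≡2x+1 : ∀ x → x + 0 + (x + 1) ≡ 2 * x + 1
  x+0+[x+1]≡2x+1 = solve-∀

∑w²-suc : ∀ L → ∑w² (suc L) ≡ 2 * ∑w² L + 2 * ∑w L + 2 ^ L
∑w²-suc L = begin
  ∑w² (suc L)                                           ≡⟨ ∑-weight-2^[1+L] L (λ x → x * x) ⟩
  ∑ (2 ^ L) (λ q → (w q + 0) * (w q + 0) + (w q + 1) * (w q + 1))
                                                        ≡⟨ ∑-cong (2 ^ L) (λ q → square-sum (w q)) ⟩
  ∑ (2 ^ L) (λ q → 2 * (w q * w q) + 2 * w q + 1)       ≡⟨ ∑-distrib-+ (2 ^ L) _ _ ⟩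
  ∑ (2 ^ L) (λ q → 2 * (w q * w q) + 2 * w q) + ∑ (2 ^ L) (λ _ → 1)
                                                        ≡⟨ cong₂ _+_ (∑-distrib-+ (2 ^ L) _ _) (∑-count (2 ^ L)) ⟩
  ∑ (2 ^ L) (λ q → 2 * (w q * w q)) + ∑ (2 ^ L) (λ q → 2 * w q) + 2 ^ L
                                                        ≡⟨ cong (_+ 2 ^ L) (cong₂ _+_ (∑-*ˡ (2 ^ L) 2 _) (∑-*ˡ (2 ^ L) 2 w)) ⟩
  2 * ∑w² L + 2 * ∑w L + 2 ^ L                          ∎
  where
  open ≡-Reasoning
  w = weight L
  square-sum : ∀ x → (x + 0) * (x + 0) + (x + 1) * (x + 1) ≡ 2 * (x * x) + 2 * x + 1
  square-sum = solve-∀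

2*∑w≡L*2^L : ∀ L → 2 * ∑w L ≡ L * 2 ^ L
2*∑w≡L*2^L zero    = refl
2*∑w≡L*2^L (suc L) = begin
  2 * ∑w (suc L)               ≡⟨ cong (2 *_) (∑w-suc L) ⟩
  2 * (2 * ∑w L + 2 ^ L)       ≡⟨ distrib (∑w L) (2 ^ L) ⟩
  2 * (2 * ∑w L) + 2 * 2 ^ L   ≡⟨ cong (λ x → 2 * x + 2 * 2 ^ L) (2*∑w≡L*2^L L) ⟩
  2 * (L * 2 ^ L) + 2 * 2 ^ L  ≡⟨ collect L (2 ^ L) ⟩
  suc L * 2 ^ suc L            ∎
  where
  open ≡-Reasoning
  distrib : ∀ s p → 2 * (2 * s + p) ≡ 2 * (2 * s) + 2 * p
  distrib = solve-∀
  collect : ∀ l p → 2 * (l * p) + 2 * p ≡ (1 + l) * (2 * p)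
  collect = solve-∀

4*∑w²≡L*[L+1]*2^L : ∀ L → 4 * ∑w² L ≡ L * (L + 1) * 2 ^ L
4*∑w²≡L*[L+1]*2^L zero    = refl
4*∑w²≡L*[L+1]*2^L (suc L) = begin
  4 * ∑w² (suc L)                                        ≡⟨ cong (4 *_) (∑w²-suc L) ⟩
  4 * (2 * ∑w² L + 2 * ∑w L + 2 ^ L)                     ≡⟨ distrib (∑w² L) (∑w L) (2 ^ L) ⟩
  2 * (4 * ∑w² L) + 4 * (2 * ∑w L) + 4 * 2 ^ L           ≡⟨ cong₂ (λ x y → 2 * x + 4 * y + 4 * 2 ^ L) (4*∑w²≡L*[L+1]*2^L L) (2*∑w≡L*2^L L) ⟩
  2 * (L * (L + 1) * 2 ^ L) + 4 * (L * 2 ^ L) + 4 * 2 ^ L ≡⟨ collect L (2 ^ L) ⟩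
  suc L * (suc L + 1) * 2 ^ suc L                        ∎
  where
  open ≡-Reasoning
  distrib : ∀ s t p → 4 * (2 * s + 2 * t + p) ≡ 2 * (4 * s) + 4 * (2 * t) + 4 * p
  distrib = solve-∀
  collect : ∀ l p → 2 * (l * (l + 1) * p) + 4 * (l * p) + 4 * p ≡ (1 + l) * (1 + l + 1) * (2 * p)
  collect = solve-∀

∑-weight-init : ∀ L (F : ℕ → ℕ) → ∑ (2 ^ L ∸ 1) (F ∘ weight L) + F L ≡ ∑ (2 ^ L) (F ∘ weight L)
∑-weight-init L F = sym (begin
  ∑ (2 ^ L) (F ∘ weight L)                                        ≡⟨ cong (λ k → ∑ k (F ∘ weight L)) (2^L≡1+[2^L-1] L) ⟩
  ∑ (suc (2 ^ L ∸ 1)) (F ∘ weight L)                              ≡⟨ ∑-last (2 ^ L ∸ 1) (F ∘ weight L) ⟩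
  ∑ (2 ^ L ∸ 1) (F ∘ weight L) + F (weight L (2 ^ L ∸ 1))         ≡⟨ cong (λ x → ∑ (2 ^ L ∸ 1) (F ∘ weight L) + F x) (weight-2^L-1 L) ⟩
  ∑ (2 ^ L ∸ 1) (F ∘ weight L) + F L                              ∎)
  where open ≡-Reasoning

∑-weight-tail : ∀ L (F : ℕ → ℕ) → F 0 + ∑ (2 ^ L ∸ 1) (F ∘ weight L ∘ suc) ≡ ∑ (2 ^ L) (F ∘ weight L)
∑-weight-tail L F = begin
  F 0 + ∑ (2 ^ L ∸ 1) (F ∘ weight L ∘ suc)             ≡⟨ cong (λ x → F x + ∑ (2 ^ L ∸ 1) (F ∘ weight L ∘ suc)) (weight-0 L) ⟨
  ∑ (suc (2 ^ L ∸ 1)) (F ∘ weight L)                   ≡⟨ cong (λ k → ∑ k (F ∘ weight L)) (2^L≡1+[2^L-1] L) ⟨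
  ∑ (2 ^ L) (F ∘ weight L)                             ∎
  where open ≡-Reasoning

∑ww⁺-suc : ∀ L → ∑ww⁺ (suc L) ≡ ∑w² L + ∑w L + (∑ww⁺ L + ∑w L)
∑ww⁺-suc L = begin
  ∑ (2 ^ suc L ∸ 1) f                                     ≡⟨ cong (λ k → ∑ k f) (2^[1+L]-1≡[2^L-1]*2+1 L) ⟩
  ∑ (m * 2 + 1) f                                         ≡⟨ ∑-split (m * 2) 1 f ⟩
  ∑ (m * 2) f + (f (m * 2 + 0) + 0)                       ≡⟨ cong₂ _+_ (∑-pairs m f) (+-identityʳ _) ⟩
  ∑ m (λ q → f (q * 2 + 0) + f (q * 2 + 1)) + f (m * 2 + 0)
                                                          ≡⟨ cong₂ _+_ (∑-cong m (λ q → cong₂ _+_ (f-even q) (f-odd q))) (f-even m) ⟩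
  ∑ m (λ q → F (w q) + (w q * w (suc q) + w (suc q))) + F (w m)
                                                          ≡⟨ cong₂ _+_ (∑-distrib-+ m _ _) (cong F (weight-2^L-1 L)) ⟩
  ∑ m (F ∘ w) + ∑ m (λ q → w q * w (suc q) + w (suc q)) + F L
                                                          ≡⟨ +-exchange (∑ m (F ∘ w)) _ (F L) ⟩
  (∑ m (F ∘ w) + F L) + ∑ m (λ q → w q * w (suc q) + w (suc q))
                                                          ≡⟨ cong₂ _+_ (∑-weight-init L F) (∑-distrib-+ m _ _) ⟩
  ∑ (2 ^ L) (F ∘ w) + (∑ww⁺ L + ∑ m (w ∘ suc))            ≡⟨ cong₂ (λ x y → x + (∑ww⁺ L + y)) (∑-distrib-+ (2 ^ L) _ _) (∑-weight-tail L (λ x → x)) ⟩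
  ∑w² L + ∑w L + (∑ww⁺ L + ∑w L)                          ∎
  where
  open ≡-Reasoning
  m = 2 ^ L ∸ 1
  w = weight L
  w′ = weight (suc L)
  f = λ v → w′ v * w′ (suc v)
  F = λ x → x * x + x
  +-exchange : ∀ a b c → a + b + c ≡ a + c + b
  +-exchange = solve-∀
  x[x+1] : ∀ x → (x + 0) * (x + 1) ≡ x * x + x
  x[x+1] = solve-∀
  [x+1]y : ∀ x y → (x + 1) * (y + 0) ≡ x * y + y
  [x+1]y = solve-∀
  suc-even : ∀ q → suc (q * 2 + 0) ≡ q * 2 + 1
  suc-even = solve-∀
  suc-odd : ∀ q → suc (q * 2 + 1) ≡ suc q * 2 + 0
  suc-odd = solve-∀
  f-even : ∀ q → f (q * 2 + 0) ≡ F (w q)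
  f-even q = trans (cong₂ _*_ (weight-suc L q 0 (s≤s z≤n)) (trans (cong w′ (suc-even q)) (weight-suc L q 1 (s≤s (s≤s z≤n)))))
                   (x[x+1] (w q))
  f-odd : ∀ q → f (q * 2 + 1) ≡ w q * w (suc q) + w (suc q)
  f-odd q = trans (cong₂ _*_ (weight-suc L q 1 (s≤s (s≤s z≤n))) (trans (cong w′ (suc-odd q)) (weight-suc L (suc q) 0 (s≤s z≤n))))
                  ([x+1]y (w q) (w (suc q)))

4*∑ww⁺+4*2^L≡2^L*[L*L+L]+4 : ∀ L → 4 * ∑ww⁺ L + 4 * 2 ^ L ≡ 2 ^ L * (L * L + L) + 4
4*∑ww⁺+4*2^L≡2^L*[L*L+L]+4 zero    = refl
4*∑ww⁺+4*2^L≡2^L*[L*L+L]+4 (suc L) = begin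
  4 * ∑ww⁺ (suc L) + 4 * 2 ^ suc L
    ≡⟨ cong (λ x → 4 * x + 4 * 2 ^ suc L) (∑ww⁺-suc L) ⟩
  4 * (∑w² L + ∑w L + (∑ww⁺ L + ∑w L)) + 4 * (2 * 2 ^ L)
    ≡⟨ distrib (∑w² L) (∑w L) (∑ww⁺ L) (2 ^ L) ⟩
  4 * ∑w² L + 4 * (2 * ∑w L) + (4 * ∑ww⁺ L + 4 * 2 ^ L) + 4 * 2 ^ L
    ≡⟨ cong₃ (λ x y z → x + 4 * y + z + 4 * 2 ^ L) (4*∑w²≡L*[L+1]*2^L L) (2*∑w≡L*2^L L) (4*∑ww⁺+4*2^L≡2^L*[L*L+L]+4 L) ⟩
  L * (L + 1) * 2 ^ L + 4 * (L * 2 ^ L) + (2 ^ L * (L * L + L) + 4) + 4 * 2 ^ L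
    ≡⟨ collect L (2 ^ L) ⟩
  2 ^ suc L * (suc L * suc L + suc L) + 4 ∎
  where
  open ≡-Reasoning
  distrib : ∀ a b d p → 4 * (a + b + (d + b)) + 4 * (2 * p) ≡ 4 * a + 4 * (2 * b) + (4 * d + 4 * p) + 4 * p
  distrib = solve-∀
  collect : ∀ l p → l * (l + 1) * p + 4 * (l * p) + (p * (l * l + l) + 4) + 4 * p ≡ 2 * p * ((1 + l) * (1 + l) + (1 + l)) + 4
  collect = solve-∀

4*[∑ww⁺+m]≡[L*L+L]*[1+m] : ∀ L → 4 * (∑ww⁺ L + (2 ^ L ∸ 1)) ≡ (L * L + L) * suc (2 ^ L ∸ 1)
4*[∑ww⁺+m]≡[L*L+L]*[1+m] L = +-cancelʳ-≡ 4 _ _ (begin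
  4 * (∑ww⁺ L + m) + 4          ≡⟨ shift (∑ww⁺ L) m ⟩
  4 * ∑ww⁺ L + 4 * suc m        ≡⟨ cong (λ p → 4 * ∑ww⁺ L + 4 * p) (2^L≡1+[2^L-1] L) ⟨
  4 * ∑ww⁺ L + 4 * 2 ^ L        ≡⟨ 4*∑ww⁺+4*2^L≡2^L*[L*L+L]+4 L ⟩
  2 ^ L * (L * L + L) + 4       ≡⟨ cong (λ p → p * (L * L + L) + 4) (2^L≡1+[2^L-1] L) ⟩
  suc m * (L * L + L) + 4       ≡⟨ cong (_+ 4) (*-comm (suc m) (L * L + L)) ⟩
  (L * L + L) * suc m + 4       ∎)
  where
  open ≡-Reasoning
  m = 2 ^ L ∸ 1
  shift : ∀ d m → 4 * (d + m) + 4 ≡ 4 * d + 4 * (1 + m)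
  shift = solve-∀

-- Runs

unruns : List (Bool × ℕ) → List Bool
unruns []             = []
unruns ((a , L) ∷ ps) = replicate L a ++ unruns ps

unruns-runs : ∀ bs → unruns (runs bs) ≡ bs
unruns-runs []       = refl
unruns-runs (b ∷ bs) with runs bs | unruns-runs bs
... | []           | eq = cong (b ∷_) eq
... | (a , k) ∷ rs | eq with b ≟ᵇ a
...   | yes refl = cong (b ∷_) eq
...   | no  _    = cong (b ∷_) eq

runs-positive : ∀ bs → All (λ r → 1 ≤ proj₂ r) (runs bs)
runs-positive []       = []
runs-positive (b ∷ bs) with runs bs | runs-positive bs
... | []           | _        = s≤s z≤n ∷ []
... | (a , k) ∷ rs | p ∷ ps with b ≟ᵇ a
...   | yes refl = s≤s z≤n ∷ ps
...   | no  _    = s≤s z≤n ∷ p ∷ ps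

length-unruns : ∀ ps → length (unruns ps) ≡ sum (map proj₂ ps)
length-unruns []             = refl
length-unruns ((a , L) ∷ ps) = trans (length-++ (replicate L a)) (cong₂ _+_ (length-replicate L) (length-unruns ps))

take-length-++ : ∀ {A : Set} (xs ys : List A) → take (length xs) (xs ++ ys) ≡ xs
take-length-++ []       ys = refl
take-length-++ (x ∷ xs) ys = cong (x ∷_) (take-length-++ xs ys)

drop-length-++ : ∀ {A : Set} (xs ys : List A) → drop (length xs) (xs ++ ys) ≡ ys
drop-length-++ []       ys = refl
drop-length-++ (x ∷ xs) ys = drop-length-++ xs ys

drop-lookup : ∀ (ps : List (Bool × ℕ)) (i : Fin (length ps)) →
  drop (toℕ i) (map proj₂ ps) ≡ proj₂ (lookup ps i) ∷ drop (suc (toℕ i)) (map proj₂ ps)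
drop-lookup (p ∷ ps) Fin.zero    = refl
drop-lookup (p ∷ ps) (Fin.suc i) = drop-lookup ps i

sum-take-suc : ∀ (ps : List (Bool × ℕ)) (i : Fin (length ps)) →
  sum (take (suc (toℕ i)) (map proj₂ ps)) ≡ sum (take (toℕ i) (map proj₂ ps)) + proj₂ (lookup ps i)
sum-take-suc (p ∷ ps) Fin.zero    = +-comm (proj₂ p) 0
sum-take-suc (p ∷ ps) (Fin.suc i) = trans (cong (proj₂ p +_) (sum-take-suc ps i)) (sym (+-assoc (proj₂ p) _ _))

sum-around-lookup : ∀ (ps : List (Bool × ℕ)) (i : Fin (length ps)) →
  sum (map proj₂ ps) ≡ sum (take (toℕ i) (map proj₂ ps)) + proj₂ (lookup ps i) + sum (drop (suc (toℕ i)) (map proj₂ ps))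
sum-around-lookup ps i = begin
  sum Ls                                                     ≡⟨ cong sum (take++drop≡id (suc (toℕ i)) Ls) ⟨
  sum (take (suc (toℕ i)) Ls ++ drop (suc (toℕ i)) Ls)       ≡⟨ sum-++ (take (suc (toℕ i)) Ls) _ ⟩
  sum (take (suc (toℕ i)) Ls) + sum (drop (suc (toℕ i)) Ls)  ≡⟨ cong (_+ sum (drop (suc (toℕ i)) Ls)) (sum-take-suc ps i) ⟩
  sum (take (toℕ i) Ls) + proj₂ (lookup ps i) + sum (drop (suc (toℕ i)) Ls) ∎
  where
  open ≡-Reasoning
  Ls = map proj₂ ps

take-drop-unruns : ∀ (ps : List (Bool × ℕ)) (i : Fin (length ps)) →
  take (proj₂ (lookup ps i)) (drop (sum (take (toℕ i) (map proj₂ ps))) (unruns ps)) ≡ replicate (proj₂ (lookup ps i)) (proj₁ (lookup ps i))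
take-drop-unruns ((a , L) ∷ ps) Fin.zero =
  trans (cong (λ l → take l (replicate L a ++ unruns ps)) (sym (length-replicate L))) (take-length-++ (replicate L a) (unruns ps))
take-drop-unruns ((a , L) ∷ ps) (Fin.suc i) = trans (cong (take (proj₂ (lookup ps i))) skip) (take-drop-unruns ps i)
  where
  P = sum (take (toℕ i) (map proj₂ ps))
  skip : drop (L + P) (replicate L a ++ unruns ps) ≡ drop P (unruns ps)
  skip = begin
    drop (L + P) (replicate L a ++ unruns ps)          ≡⟨ drop-drop L P _ ⟨
    drop P (drop L (replicate L a ++ unruns ps))       ≡⟨ cong (λ l → drop P (drop l (replicate L a ++ unruns ps))) (length-replicate L) ⟨
    drop P (drop (length (replicate L a)) (replicate L a ++ unruns ps)) ≡⟨ cong (drop P) (drop-length-++ (replicate L a) (unruns ps)) ⟩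
    drop P (unruns ps)                                 ∎
    where open ≡-Reasoning

-- Carries

carry-split : ∀ M s → s < M + M → Σ[ e ∈ ℕ ] (e < M × s ≡ bit (does (M ≤? s)) * M + e)
carry-split M s s<2M = split (M ≤? s)
  where
  split : (M≤?s : Dec (M ≤ s)) → Σ[ e ∈ ℕ ] (e < M × s ≡ bit (does M≤?s) * M + e)
  split (yes M≤s) = s ∸ M , +-cancelˡ-< M (s ∸ M) M (subst (_< M + M) (sym (m+[n∸m]≡n M≤s)) s<2M)
                          , trans (sym (m+[n∸m]≡n M≤s)) (cong (_+ (s ∸ M)) (sym (+-identityʳ M)))
  split (no  M≰s) = s , ≰⇒> M≰s , refl

≤⇔*≤*+ : ∀ {M e} X Y → e < M → Y ≤ X ⇔ Y * M ≤ X * M + e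
≤⇔*≤*+ {M} {e} X Y e<M = mk⇔ (λ Y≤X → ≤-trans (*-monoˡ-≤ M Y≤X) (m≤m+n (X * M) e)) to-≤
  where
  to-≤ : Y * M ≤ X * M + e → Y ≤ X
  to-≤ YM≤XM+e with Y ≤? X
  ... | yes Y≤X = Y≤X
  ... | no  Y≰X = ⊥-elim (<⇒≱ XM+e<YM YM≤XM+e)
    where
    open ≤-Reasoning
    XM+e<YM : X * M + e < Y * M
    XM+e<YM = begin-strict
      X * M + e <⟨ +-monoʳ-< (X * M) e<M ⟩
      X * M + M ≡⟨ +-comm (X * M) M ⟩
      suc X * M ≤⟨ *-monoˡ-≤ M (≰⇒> Y≰X) ⟩
      Y * M     ∎

carry-concat : ∀ L R A B a b → a < 2 ^ R → b < 2 ^ R →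
  does (2 ^ L ≤? A + B + bit (does (2 ^ R ≤? a + b))) ≡ does (2 ^ (L + R) ≤? (A * 2 ^ R + a) + (B * 2 ^ R + b))
carry-concat L R A B a b a<2^R b<2^R with carry-split (2 ^ R) (a + b) (+-mono-< a<2^R b<2^R)
... | e , e<2^R , a+b≡cM+e = does-⇔ scaled (2 ^ L ≤? X) (2 ^ (L + R) ≤? total)
  where
  c = bit (does (2 ^ R ≤? a + b))
  X = A + B + c
  total = (A * 2 ^ R + a) + (B * 2 ^ R + b)
  regroup : ∀ A B M a b → (A * M + a) + (B * M + b) ≡ (A + B) * M + (a + b)
  regroup = solve-∀
  collect : ∀ A B M c e → (A + B) * M + (c * M + e) ≡ (A + B + c) * M + e
  collect = solve-∀
  total≡ : total ≡ X * 2 ^ R + e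
  total≡ = trans (regroup A B (2 ^ R) a b) (trans (cong ((A + B) * 2 ^ R +_) a+b≡cM+e) (collect A B (2 ^ R) c e))
  scaled : 2 ^ L ≤ X ⇔ 2 ^ (L + R) ≤ total
  scaled = subst₂ (λ p t → 2 ^ L ≤ X ⇔ p ≤ t) (sym (^-distribˡ-+-* 2 L R)) (sym total≡) (≤⇔*≤*+ X (2 ^ L) e<2^R)

cutBlocks : List ℕ → List Bool → List Bool → List (List Bool × List Bool × ℕ)
cutBlocks Ls xs ys = zipWith (λ u vL → (u , vL)) (cut Ls xs) (zipWith _,_ (cut Ls ys) Ls)

drop-cutBlocks : ∀ k Ls xs ys →
  drop k (cutBlocks Ls xs ys) ≡ cutBlocks (drop k Ls) (drop (sum (take k Ls)) xs) (drop (sum (take k Ls)) ys)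
drop-cutBlocks zero    Ls       xs ys = refl
drop-cutBlocks (suc k) []       xs ys = refl
drop-cutBlocks (suc k) (L ∷ Ls) xs ys =
  trans (drop-cutBlocks k Ls (drop L xs) (drop L ys)) (cong₂ (cutBlocks (drop k Ls)) (drop-drop L _ xs) (drop-drop L _ ys))

length-drop-≡ : ∀ L R (xs : List Bool) → length xs ≡ L + R → length (drop L xs) ≡ R
length-drop-≡ L R xs len≡ = trans (length-drop L xs) (trans (cong (_∸ L) len≡) (m+n∸m≡n L R))

val-take-drop : ∀ L R (xs : List Bool) → length xs ≡ L + R → val xs ≡ val (take L xs) * 2 ^ R + val (drop L xs)
val-take-drop L R xs len≡ = begin
  val xs                                                ≡⟨ cong val (take++drop≡id L xs) ⟨
  val (take L xs ++ drop L xs)                          ≡⟨ val-++ (take L xs) (drop L xs) ⟩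
  val (take L xs) * 2 ^ length (drop L xs) + val (drop L xs) ≡⟨ cong (λ r → val (take L xs) * 2 ^ r + val (drop L xs)) (length-drop-≡ L R xs len≡) ⟩
  val (take L xs) * 2 ^ R + val (drop L xs)             ∎
  where open ≡-Reasoning

carryOut-cutBlocks : ∀ Ls xs ys → length xs ≡ sum Ls → length ys ≡ sum Ls →
  carryOut (cutBlocks Ls xs ys) ≡ does (2 ^ sum Ls ≤? val xs + val ys)
carryOut-cutBlocks [] [] [] _ _ = refl
carryOut-cutBlocks (L ∷ Ls) xs ys |xs| |ys| = begin
  does (2 ^ L ≤? val (take L xs) + val (take L ys) + bit (carryOut (cutBlocks Ls (drop L xs) (drop L ys))))
    ≡⟨ cong (λ c → does (2 ^ L ≤? val (take L xs) + val (take L ys) + bit c)) (carryOut-cutBlocks Ls (drop L xs) (drop L ys) |xs′| |ys′|) ⟩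
  does (2 ^ L ≤? val (take L xs) + val (take L ys) + bit (does (2 ^ R ≤? val (drop L xs) + val (drop L ys))))
    ≡⟨ carry-concat L R (val (take L xs)) (val (take L ys)) _ _ (val<2^ (drop L xs) |xs′|) (val<2^ (drop L ys) |ys′|) ⟩
  does (2 ^ (L + R) ≤? (val (take L xs) * 2 ^ R + val (drop L xs)) + (val (take L ys) * 2 ^ R + val (drop L ys)))
    ≡⟨ cong₂ (λ x y → does (2 ^ (L + R) ≤? x + y)) (val-take-drop L R xs |xs|) (val-take-drop L R ys |ys|) ⟨
  does (2 ^ (L + R) ≤? val xs + val ys) ∎
  where
  open ≡-Reasoning
  R = sum Ls
  |xs′| = length-drop-≡ L R xs |xs|
  |ys′| = length-drop-≡ L R ys |ys|
  val<2^ : ∀ zs → length zs ≡ R → val zs < 2 ^ R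
  val<2^ zs |zs| = subst (λ r → val zs < 2 ^ r) |zs| (val<2^length zs)

module _ (M : ℕ) .{{_ : NonZero M}} where

  [m+n]/d≡m/d+n/d+carry : ∀ x y → (x + y) / M ≡ x / M + y / M + bit (does (M ≤? x % M + y % M))
  [m+n]/d≡m/d+n/d+carry x y with carry-split M (x % M + y % M) (+-mono-< (m%n<n x M) (m%n<n y M))
  ... | e , e<M , split≡ = trans (cong (_/ M) x+y≡) ([q*m+r]/m≡q _ e e<M)
    where
    c = bit (does (M ≤? x % M + y % M))
    regroup : ∀ a b c d m → (a + b * m) + (c + d * m) ≡ (b + d) * m + (a + c)
    regroup = solve-∀
    collect : ∀ b d m c e → (b + d) * m + (c * m + e) ≡ (b + d + c) * m + e
    collect = solve-∀
    x+y≡ : x + y ≡ (x / M + y / M + c) * M + e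
    x+y≡ = begin
      x + y                                          ≡⟨ cong₂ _+_ (m≡m%n+[m/n]*n x M) (m≡m%n+[m/n]*n y M) ⟩
      (x % M + x / M * M) + (y % M + y / M * M)      ≡⟨ regroup (x % M) (x / M) (y % M) (y / M) M ⟩
      (x / M + y / M) * M + (x % M + y % M)          ≡⟨ cong ((x / M + y / M) * M +_) split≡ ⟩
      (x / M + y / M) * M + (c * M + e)              ≡⟨ collect (x / M) (y / M) M c e ⟩
      (x / M + y / M + c) * M + e                    ∎
      where open ≡-Reasoning

  [m+n+o]%d≡[m%d+n%d+o]%d : ∀ x y z → (x + y + z) % M ≡ (x % M + y % M + z) % M
  [m+n+o]%d≡[m%d+n%d+o]%d x y z = begin
    (x + y + z) % M                       ≡⟨ %-distribˡ-+ (x + y) z M ⟩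
    ((x + y) % M + z % M) % M             ≡⟨ cong (λ t → (t + z % M) % M) (%-distribˡ-+ x y M) ⟩
    ((x % M + y % M) % M + z % M) % M     ≡⟨ %-distribˡ-+ (x % M + y % M) z M ⟨
    (x % M + y % M + z) % M               ∎
    where open ≡-Reasoning

-- Naturals as rationals

private
  toℚᵘ-÷ : ∀ i b .{{_ : NonZero b}} → toℚᵘ (i ÷ℚ b) ℚᵘ.≃ mkℚᵘ i (pred b)
  toℚᵘ-÷ i (suc b) = toℚᵘ-fromℚᵘ (mkℚᵘ i b)

÷-cross : ∀ x y b d .{{_ : NonZero b}} .{{_ : NonZero d}} → x * d ≡ y * b → (ℤ.+ x) ÷ℚ b ≡ (ℤ.+ y) ÷ℚ d
÷-cross x y b@(suc _) d@(suc _) xd≡yb = toℚᵘ-injective (begin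
  toℚᵘ ((ℤ.+ x) ÷ℚ b)    ≈⟨ toℚᵘ-÷ (ℤ.+ x) b ⟩
  mkℚᵘ (ℤ.+ x) (pred b)  ≈⟨ *≡* (trans (sym (ℤ.pos-* x d)) (trans (cong ℤ.+_ xd≡yb) (ℤ.pos-* y b))) ⟩
  mkℚᵘ (ℤ.+ y) (pred d)  ≈⟨ toℚᵘ-÷ (ℤ.+ y) d ⟨
  toℚᵘ ((ℤ.+ y) ÷ℚ d)    ∎)
  where open ℚᵘ.≃-Reasoning

ι : ℕ → ℚ
ι a = ℤ.+ a ÷ℚ 1

1/ℕ : (b : ℕ) → .{{NonZero b}} → ℚ
1/ℕ b = ℤ.+ 1 ÷ℚ b

½ ¼ : ℚ
½ = 1/ℕ 2
¼ = 1/ℕ 4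

ι-+ : ∀ a b → ι (a + b) ≡ ι a +ℚ ι b
ι-+ a b = toℚᵘ-injective (begin
  toℚᵘ (ι (a + b))                              ≈⟨ toℚᵘ-÷ (ℤ.+ (a + b)) 1 ⟩
  mkℚᵘ (ℤ.+ (a + b)) 0                          ≈⟨ *≡* (cong (ℤ._* ℤ.+ 1) (sym (cong₂ ℤ._+_ (ℤ.*-identityʳ (ℤ.+ a)) (ℤ.*-identityʳ (ℤ.+ b))))) ⟩
  mkℚᵘ (ℤ.+ a) 0 ℚᵘ.+ mkℚᵘ (ℤ.+ b) 0            ≈⟨ ℚᵘ.+-cong (toℚᵘ-÷ (ℤ.+ a) 1) (toℚᵘ-÷ (ℤ.+ b) 1) ⟨
  toℚᵘ (ι a) ℚᵘ.+ toℚᵘ (ι b)                    ≈⟨ toℚᵘ-homo-+ (ι a) (ι b) ⟨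
  toℚᵘ (ι a +ℚ ι b)                             ∎)
  where open ℚᵘ.≃-Reasoning

ι-* : ∀ a b → ι (a * b) ≡ ι a *ℚ ι b
ι-* a b = toℚᵘ-injective (begin
  toℚᵘ (ι (a * b))                              ≈⟨ toℚᵘ-÷ (ℤ.+ (a * b)) 1 ⟩
  mkℚᵘ (ℤ.+ (a * b)) 0                          ≈⟨ *≡* (cong (ℤ._* ℤ.+ 1) (ℤ.pos-* a b)) ⟩
  mkℚᵘ (ℤ.+ a) 0 ℚᵘ.* mkℚᵘ (ℤ.+ b) 0            ≈⟨ ℚᵘ.*-cong (toℚᵘ-÷ (ℤ.+ a) 1) (toℚᵘ-÷ (ℤ.+ b) 1) ⟨
  toℚᵘ (ι a) ℚᵘ.* toℚᵘ (ι b)                    ≈⟨ toℚᵘ-homo-* (ι a) (ι b) ⟨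
  toℚᵘ (ι a *ℚ ι b)                             ∎)
  where open ℚᵘ.≃-Reasoning

÷≡ι*1/ℕ : ∀ a b .{{_ : NonZero b}} → ℤ.+ a ÷ℚ b ≡ ι a *ℚ 1/ℕ b
÷≡ι*1/ℕ a b@(suc _) = toℚᵘ-injective (begin
  toℚᵘ (ℤ.+ a ÷ℚ b)                             ≈⟨ toℚᵘ-÷ (ℤ.+ a) b ⟩
  mkℚᵘ (ℤ.+ a) (pred b)                         ≈⟨ *≡* (cong₂ ℤ._*_ (sym (ℤ.*-identityʳ (ℤ.+ a))) (ℤ.*-identityˡ (ℤ.+ b))) ⟩
  mkℚᵘ (ℤ.+ a) 0 ℚᵘ.* mkℚᵘ (ℤ.+ 1) (pred b)     ≈⟨ ℚᵘ.*-cong (toℚᵘ-÷ (ℤ.+ a) 1) (toℚᵘ-÷ (ℤ.+ 1) b) ⟨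
  toℚᵘ (ι a) ℚᵘ.* toℚᵘ (1/ℕ b)                  ≈⟨ toℚᵘ-homo-* (ι a) (1/ℕ b) ⟨
  toℚᵘ (ι a *ℚ 1/ℕ b)                           ∎)
  where open ℚᵘ.≃-Reasoning

ι*1/ℕ≡1 : ∀ b .{{_ : NonZero b}} → ι b *ℚ 1/ℕ b ≡ 1ℚ
ι*1/ℕ≡1 b = trans (sym (÷≡ι*1/ℕ b b)) (÷-cross b 1 b 1 (*-comm b 1))

ι-∸ : ∀ x a y → x + a ≡ y → ι x ≡ ι y -ℚ ι a
ι-∸ x a y x+a≡y = trans (x≡x+a-a (ι x) (ι a)) (cong (_-ℚ ι a) (trans (sym (ι-+ x a)) (cong ι x+a≡y)))
  where
  open ℚ-Solver
  x≡x+a-a : ∀ x a → x ≡ x +ℚ a -ℚ a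
  x≡x+a-a = solve 2 (λ x a → x := x :+ a :- a) refl

ι-scale : ∀ c x y m .{{_ : NonZero c}} .{{_ : NonZero m}} → c * x ≡ y * suc m →
  ι x *ℚ 1/ℕ m ≡ ι y *ℚ 1/ℕ c *ℚ (1ℚ +ℚ 1/ℕ m)
ι-scale c x y m cx≡y[1+m] = begin
  ι x *ℚ 1/ℕ m                                 ≡⟨ cong (_*ℚ 1/ℕ m) ιx≡ ⟩
  ι y *ℚ (1ℚ +ℚ ι m) *ℚ 1/ℕ c *ℚ 1/ℕ m         ≡⟨ expand (ι y) (ι m) (1/ℕ c) (1/ℕ m) ⟩
  ι y *ℚ 1/ℕ c *ℚ (ι m *ℚ 1/ℕ m +ℚ 1/ℕ m)      ≡⟨ cong (λ u → ι y *ℚ 1/ℕ c *ℚ (u +ℚ 1/ℕ m)) (ι*1/ℕ≡1 m) ⟩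
  ι y *ℚ 1/ℕ c *ℚ (1ℚ +ℚ 1/ℕ m)                ∎
  where
  open ≡-Reasoning
  ιx≡ : ι x ≡ ι y *ℚ (1ℚ +ℚ ι m) *ℚ 1/ℕ c
  ιx≡ = trans (÷-cross x (y * suc m) 1 c (trans (*-comm x c) (trans cx≡y[1+m] (sym (*-identityʳ _)))))
              (trans (÷≡ι*1/ℕ (y * suc m) c) (cong (_*ℚ 1/ℕ c) (trans (ι-* y (suc m)) (cong (ι y *ℚ_) (ι-+ 1 m)))))
  expand : ∀ y μ j i → y *ℚ (1ℚ +ℚ μ) *ℚ j *ℚ i ≡ y *ℚ j *ℚ (μ *ℚ i +ℚ i)
  expand = solve 4 (λ y μ j i → y :* (con 1ℚ :+ μ) :* j :* i := y :* j :* (μ :* i :+ i)) refl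
    where open ℚ-Solver

inv2^L-1≡1/ℕ : ∀ {L} (1≤L : 1 ≤ L) → inv2^L-1 L ≡ 1/ℕ (2 ^ L ∸ 1) {{2^L∸1-nonZero 1≤L}}
inv2^L-1≡1/ℕ (s≤s z≤n) = refl

mean-≡ : ∀ (ys : List ℕ) c Z D .{{_ : NonZero D}} → ys ≢ [] → sum ys ≡ c * Z → length ys ≡ c * D → mean ys ≡ (ℤ.+ Z) ÷ℚ D
mean-≡ []       c Z D ys≢[] _    _       = ⊥-elim (ys≢[] refl)
mean-≡ (y ∷ ys) c Z D _     sum≡ length≡ = ÷-cross (sum (y ∷ ys)) Z (length (y ∷ ys)) D (begin
  sum (y ∷ ys) * D          ≡⟨ cong (_* D) sum≡ ⟩
  c * Z * D                 ≡⟨ swap c Z D ⟩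
  Z * (c * D)               ≡⟨ cong (Z *_) length≡ ⟨
  Z * length (y ∷ ys)       ∎)
  where
  open ≡-Reasoning
  swap : ∀ c z d → c * z * d ≡ z * (c * d)
  swap = solve-∀

-- Conditioning on the carries around a block

∑-by-digits : ∀ H B M .{{_ : NonZero B}} .{{_ : NonZero M}} (f : ℕ → ℕ) (φ : ℕ → ℕ → ℕ) →
  (∀ s → f s ≡ φ (s / M % B) (s % M)) → ∑ (H * B * M) f ≡ H * ∑ B (λ u → ∑ M (φ u))
∑-by-digits H B M f φ f≡φ = begin
  ∑ (H * B * M) f                                       ≡⟨ ∑-divmod (H * B) M f ⟩
  ∑ (H * B) (λ q → ∑ M (λ r → f (q * M + r)))           ≡⟨ ∑-cong (H * B) (λ q → ∑-cong-< M (λ r r<M → trans (f≡φ _)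
                                                             (cong₂ φ (cong (_% B) ([q*m+r]/m≡q q r r<M)) ([q*m+r]%m≡r q r r<M)))) ⟩
  ∑ (H * B) (λ q → ∑ M (φ (q % B)))                     ≡⟨ ∑-divmod H B _ ⟩
  ∑ H (λ h → ∑ B (λ u → ∑ M (φ ((h * B + u) % B))))     ≡⟨ ∑-cong H (λ h → ∑-cong-< B (λ u u<B → cong (λ v → ∑ M (φ v)) ([q*m+r]%m≡r h u u<B))) ⟩
  ∑ H (λ _ → ∑ B (λ u → ∑ M (φ u)))                     ≡⟨ ∑-const H _ ⟩
  H * ∑ B (λ u → ∑ M (φ u))                             ∎
  where open ≡-Reasoning

filterᵇ-cong : ∀ {p q : ℕ → Bool} → (∀ x → p x ≡ q x) → ∀ xs → filterᵇ p xs ≡ filterᵇ q xs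
filterᵇ-cong {p} {q} p≡q []       = refl
filterᵇ-cong {p} {q} p≡q (x ∷ xs) with p x | q x | p≡q x
... | true  | .true  | refl = cong (x ∷_) (filterᵇ-cong p≡q xs)
... | false | .false | refl = filterᵇ-cong p≡q xs

≟ᵇ-∧-subst : ∀ c e (h : Bool → Bool) → does (c ≟ᵇ e) ∧ h c ≡ does (c ≟ᵇ e) ∧ h e
≟ᵇ-∧-subst false false h = refl
≟ᵇ-∧-subst false true  h = refl
≟ᵇ-∧-subst true  false h = refl
≟ᵇ-∧-subst true  true  h = refl

not-≟ᵇ : ∀ c e → not (does (c ≟ᵇ e)) ≡ does (c ≟ᵇ not e)
not-≟ᵇ false false = refl
not-≟ᵇ false true  = refl
not-≟ᵇ true  false = refl
not-≟ᵇ true  true  = refl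

if-≟ᵇ-subst : ∀ c e (T : Bool → ℕ) → (if does (c ≟ᵇ e) then T c else 0) ≡ (if does (c ≟ᵇ e) then T e else 0)
if-≟ᵇ-subst false false T = refl
if-≟ᵇ-subst false true  T = refl
if-≟ᵇ-subst true  false T = refl
if-≟ᵇ-subst true  true  T = refl

if-∧ : ∀ b c (x : ℕ) → (if b ∧ c then x else 0) ≡ (if b then (if c then x else 0) else 0)
if-∧ false c x = refl
if-∧ true  c x = refl

if-≟ᵇ-≡ : ∀ {c a} (x : ℕ) → c ≡ a → (if does (c ≟ᵇ a) then x else 0) ≡ x
if-≟ᵇ-≡ {false} x refl = refl
if-≟ᵇ-≡ {true}  x refl = refl

if-≟ᵇ-≢ : ∀ {c a} (x : ℕ) → c ≡ not a → (if does (c ≟ᵇ a) then x else 0) ≡ 0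
if-≟ᵇ-≢ {a = false} x refl = refl
if-≟ᵇ-≢ {a = true}  x refl = refl

coord : Fin 2 → ℕ → ℕ → ℕ
coord Fin.zero    x y = x
coord (Fin.suc _) x y = y

-- The covariance matrix of (X, Y) under the uniform distribution on a sample of size D,
-- given Z with Z g = the sum of g X Y over the sample.
covOfSums : (D : ℕ) .{{_ : NonZero D}} → ((ℕ → ℕ → ℕ) → ℕ) → Fin 2 → Fin 2 → ℚ
covOfSums D Z j l = (ℤ.+ Z (λ x y → coord j x y * coord l x y)) ÷ℚ D -ℚ ((ℤ.+ Z (coord j)) ÷ℚ D) *ℚ ((ℤ.+ Z (coord l)) ÷ℚ D)

covOfSums-cong : ∀ D .{{_ : NonZero D}} {Z Z′ : (ℕ → ℕ → ℕ) → ℕ} → (∀ g → Z g ≡ Z′ g) → ∀ j l → covOfSums D Z j l ≡ covOfSums D Z′ j l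
covOfSums-cong D Z≡Z′ j l = cong₃ (λ u v w → (ℤ.+ u) ÷ℚ D -ℚ ((ℤ.+ v) ÷ℚ D) *ℚ ((ℤ.+ w) ÷ℚ D)) (Z≡Z′ _) (Z≡Z′ _) (Z≡Z′ _)

-- The term g X Y contributed by a block of S with value u, when the block of σ is a^L, the
-- carry into the block is e and the carry out of it is required to be a (else 0).
blockTerm : ℕ → Bool → Bool → (ℕ → ℕ → ℕ) → ℕ → ℕ
blockTerm L a e g u =
  if does (does (2 ^ L ≤? u + val (replicate L a) + bit e) ≟ᵇ a)
  then g (weight L u) (weight L (u + val (replicate L a) + bit e)) else 0

diagonalSums : ℕ → (ℕ → ℕ → ℕ) → ℕ
diagonalSums L g = ∑ (2 ^ L) (λ u → g (weight L u) (weight L u))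

shiftSums : ℕ → (ℕ → ℕ → ℕ) → ℕ
shiftSums L g = ∑ (2 ^ L ∸ 1) (λ v → g (weight L v) (weight L (suc v)))

module _ (L : ℕ) (g : ℕ → ℕ → ℕ) where
  private
    w = weight L
    m = 2 ^ L ∸ 1
    σ₀ = val (replicate L false)
    σ₁ = val (replicate L true)

    u+σ₀≡u : ∀ u → u + σ₀ ≡ u
    u+σ₀≡u u = trans (cong (u +_) (val-replicate-false L)) (+-identityʳ u)

    u+σ₁+1≡u+2^L : ∀ u → u + σ₁ + 1 ≡ u + 2 ^ L
    u+σ₁+1≡u+2^L u = trans (+-assoc u σ₁ 1) (cong (u +_) (val-replicate-true L))

    2^L≤u+2^L : ∀ {u t} → t ≡ u + 2 ^ L → 2 ^ L ≤ t
    2^L≤u+2^L {u} t≡ = subst (2 ^ L ≤_) (sym t≡) (m≤n+m (2 ^ L) u)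

  ∑-blockTerm-trivial : ∀ a → ∑ (2 ^ L) (blockTerm L a a g) ≡ diagonalSums L g
  ∑-blockTerm-trivial false = ∑-cong-< (2 ^ L) λ u u<2^L →
    let t≡u = trans (+-identityʳ _) (u+σ₀≡u u) in
    trans (if-≟ᵇ-≡ _ (dec-false (2 ^ L ≤? u + σ₀ + 0) (<⇒≱ (subst (_< 2 ^ L) (sym t≡u) u<2^L))))
          (cong (λ t → g (w u) (w t)) t≡u)
  ∑-blockTerm-trivial true = ∑-cong (2 ^ L) λ u →
    trans (if-≟ᵇ-≡ _ (dec-true (2 ^ L ≤? u + σ₁ + 1) (2^L≤u+2^L (u+σ₁+1≡u+2^L u))))
          (cong (g (w u)) (trans (cong w (u+σ₁+1≡u+2^L u)) (weight-+2^L L u)))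

  ∑-blockTerm-nontrivial-false : ∑ (2 ^ L) (blockTerm L false true g) ≡ shiftSums L g
  ∑-blockTerm-nontrivial-false = begin
    ∑ (2 ^ L) (blockTerm L false true g)                      ≡⟨ cong (λ k → ∑ k (blockTerm L false true g)) (2^L≡1+[2^L-1] L) ⟩
    ∑ (suc m) (blockTerm L false true g)                      ≡⟨ ∑-last m (blockTerm L false true g) ⟩
    ∑ m (blockTerm L false true g) + blockTerm L false true g m ≡⟨ cong₂ _+_ (∑-cong-< m no-overflow) overflow ⟩
    shiftSums L g + 0                                         ≡⟨ +-identityʳ _ ⟩
    shiftSums L g                                             ∎
    where
    open ≡-Reasoning
    t≡suc : ∀ u → u + σ₀ + 1 ≡ suc u
    t≡suc u = trans (cong (_+ 1) (u+σ₀≡u u)) (+-comm u 1)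
    no-overflow : ∀ v → v < m → blockTerm L false true g v ≡ g (w v) (w (suc v))
    no-overflow v v<m = trans (if-≟ᵇ-≡ _ (dec-false (2 ^ L ≤? v + σ₀ + 1)
                                 (<⇒≱ (subst₂ _<_ (sym (t≡suc v)) (sym (2^L≡1+[2^L-1] L)) (s≤s v<m)))))
                              (cong (λ t → g (w v) (w t)) (t≡suc v))
    overflow : blockTerm L false true g m ≡ 0
    overflow = if-≟ᵇ-≢ _ (dec-true (2 ^ L ≤? m + σ₀ + 1) (≤-reflexive (trans (2^L≡1+[2^L-1] L) (sym (t≡suc m)))))

  ∑-blockTerm-nontrivial-true : ∑ (2 ^ L) (blockTerm L true false g) ≡ shiftSums L (λ x y → g y x)
  ∑-blockTerm-nontrivial-true = begin
    ∑ (2 ^ L) (blockTerm L true false g)                        ≡⟨ cong (λ k → ∑ k (blockTerm L true false g)) (2^L≡1+[2^L-1] L) ⟩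
    blockTerm L true false g 0 + ∑ m (blockTerm L true false g ∘ suc) ≡⟨ cong₂ _+_ no-borrow (∑-cong m borrow) ⟩
    0 + shiftSums L (λ x y → g y x)                             ∎
    where
    open ≡-Reasoning
    t≡ : ∀ v → suc v + σ₁ + 0 ≡ v + 2 ^ L
    t≡ v = trans (+-identityʳ _) (trans (cong (_+ σ₁) (+-comm 1 v)) (trans (+-assoc v 1 σ₁) (cong (v +_) (trans (+-comm 1 σ₁) (val-replicate-true L)))))
    no-borrow : blockTerm L true false g 0 ≡ 0
    no-borrow = if-≟ᵇ-≢ _ (dec-false (2 ^ L ≤? 0 + σ₁ + 0)
                  (<⇒≱ (subst₂ _<_ (sym (+-identityʳ σ₁)) (val-replicate-true L) (m<m+n σ₁ (s≤s z≤n)))))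
    borrow : ∀ v → blockTerm L true false g (suc v) ≡ g (w (suc v)) (w v)
    borrow v = trans (if-≟ᵇ-≡ _ (dec-true (2 ^ L ≤? suc v + σ₁ + 0) (2^L≤u+2^L (t≡ v))))
                     (cong (g (w (suc v))) (trans (cong w (t≡ v)) (weight-+2^L L v)))

module Block (n α : ℕ) (i : Fin (length (rs n α))) where

  k : ℕ
  k = toℕ i

  a : Bool
  a = proj₁ (lookup (rs n α) i)

  L P R : ℕ
  L = proj₂ (lookup (rs n α) i)
  P = sum (take k (lens n α))
  R = sum (drop (suc k) (lens n α))

  private instance
    _ = 2^-nonZero L
    _ = 2^-nonZero R
    _ = 2^-nonZero n

  σᵢ : ℕ
  σᵢ = val (replicate L a)

  -- Block i occupies the bits of weights 2^R, …, 2^(R+L-1); carryIn s is c_{i+1}.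
  digit : ℕ → ℕ
  digit x = x / 2 ^ R % 2 ^ L

  carryIn : ℕ → Bool
  carryIn s = does (2 ^ R ≤? s % 2 ^ R + α % 2 ^ R)

  1≤L : 1 ≤ L
  1≤L = All.lookup (runs-positive (σ n α)) (∈-lookup i)

  n≡P+L+R : n ≡ P + L + R
  n≡P+L+R = begin
    n                                 ≡⟨ length-toBits n α ⟨
    length (σ n α)                    ≡⟨ cong length (unruns-runs (σ n α)) ⟨
    length (unruns (rs n α))          ≡⟨ length-unruns (rs n α) ⟩
    sum (lens n α)                    ≡⟨ sum-around-lookup (rs n α) i ⟩
    P + L + R                         ∎
    where open ≡-Reasoning

  toBits-around-block : ∀ x → toBits n x ≡ toBits P (x / 2 ^ R / 2 ^ L) ++ (toBits L (x / 2 ^ R) ++ toBits R x)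
  toBits-around-block x = begin
    toBits n x                                                     ≡⟨ cong (λ m → toBits m x) (trans n≡P+L+R (+-comm (P + L) R)) ⟩
    toBits (R + (P + L)) x                                         ≡⟨ toBits-+ R (P + L) x ⟩
    toBits (P + L) (x / 2 ^ R) ++ toBits R x                       ≡⟨ cong (λ m → toBits m (x / 2 ^ R) ++ toBits R x) (+-comm P L) ⟩
    toBits (L + P) (x / 2 ^ R) ++ toBits R x                       ≡⟨ cong (_++ toBits R x) (toBits-+ L P (x / 2 ^ R)) ⟩
    (toBits P (x / 2 ^ R / 2 ^ L) ++ toBits L (x / 2 ^ R)) ++ toBits R x ≡⟨ ++-assoc (toBits P _) _ _ ⟩
    toBits P (x / 2 ^ R / 2 ^ L) ++ (toBits L (x / 2 ^ R) ++ toBits R x) ∎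
    where open ≡-Reasoning

  drop-P-toBits : ∀ x → drop P (toBits n x) ≡ toBits L (x / 2 ^ R) ++ toBits R x
  drop-P-toBits x = begin
    drop P (toBits n x)                         ≡⟨ cong (drop P) (toBits-around-block x) ⟩
    drop P (high ++ rest)                       ≡⟨ cong (λ p → drop p (high ++ rest)) (length-toBits P _) ⟨
    drop (length high) (high ++ rest)           ≡⟨ drop-length-++ high rest ⟩
    rest                                        ∎
    where
    open ≡-Reasoning
    high = toBits P (x / 2 ^ R / 2 ^ L)
    rest = toBits L (x / 2 ^ R) ++ toBits R x

  take-L-drop-P-toBits : ∀ x → take L (drop P (toBits n x)) ≡ toBits L (x / 2 ^ R)
  take-L-drop-P-toBits x = begin
    take L (drop P (toBits n x))                ≡⟨ cong (take L) (drop-P-toBits x) ⟩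
    take L (block ++ low)                       ≡⟨ cong (λ l → take l (block ++ low)) (length-toBits L _) ⟨
    take (length block) (block ++ low)          ≡⟨ take-length-++ block low ⟩
    block                                       ∎
    where
    open ≡-Reasoning
    block = toBits L (x / 2 ^ R)
    low   = toBits R x

  drop-P+L-toBits : ∀ x → drop (P + L) (toBits n x) ≡ toBits R x
  drop-P+L-toBits x = begin
    drop (P + L) (toBits n x)                   ≡⟨ drop-drop P L (toBits n x) ⟨
    drop L (drop P (toBits n x))                ≡⟨ cong (drop L) (drop-P-toBits x) ⟩
    drop L (block ++ low)                       ≡⟨ cong (λ l → drop l (block ++ low)) (length-toBits L _) ⟨
    drop (length block) (block ++ low)          ≡⟨ drop-length-++ block low ⟩
    low                                         ∎
    where
    open ≡-Reasoning
    block = toBits L (x / 2 ^ R)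
    low   = toBits R x

  piece≡take-L-drop-P : ∀ bs → piece n α k bs ≡ take L (drop P bs)
  piece≡take-L-drop-P bs = cong (λ l → take l (drop P bs)) (trans (cong (_∸ P) (sum-take-suc (rs n α) i)) (m+n∸m≡n P L))

  take-L-drop-P-σ : take L (drop P (σ n α)) ≡ replicate L a
  take-L-drop-P-σ = trans (cong (λ bs → take L (drop P bs)) (sym (unruns-runs (σ n α)))) (take-drop-unruns (rs n α) i)

  digit-α≡σᵢ : digit α ≡ σᵢ
  digit-α≡σᵢ = trans (sym (val-toBits L (α / 2 ^ R))) (cong val (trans (sym (take-L-drop-P-toBits α)) take-L-drop-P-σ))

  carry-below-block : ∀ s → carryOut (cutBlocks (drop (suc k) (lens n α)) (drop (P + L) (toBits n s)) (drop (P + L) (σ n α))) ≡ carryIn s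
  carry-below-block s = begin
    carryOut (cutBlocks (drop (suc k) (lens n α)) (drop (P + L) (toBits n s)) (drop (P + L) (σ n α)))
      ≡⟨ cong₂ (λ x y → carryOut (cutBlocks (drop (suc k) (lens n α)) x y)) (drop-P+L-toBits s) (drop-P+L-toBits α) ⟩
    carryOut (cutBlocks (drop (suc k) (lens n α)) (toBits R s) (toBits R α))
      ≡⟨ carryOut-cutBlocks (drop (suc k) (lens n α)) (toBits R s) (toBits R α) (length-toBits R s) (length-toBits R α) ⟩
    does (2 ^ R ≤? val (toBits R s) + val (toBits R α))
      ≡⟨ cong₂ (λ x y → does (2 ^ R ≤? x + y)) (val-toBits R s) (val-toBits R α) ⟩
    carryIn s ∎
    where open ≡-Reasoning

  cInOf≡carryIn : ∀ s → cInOf n α k s ≡ carryIn s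
  cInOf≡carryIn s = trans (cong carryOut (drop-cutBlocks (suc k) (lens n α) (toBits n s) (σ n α)))
    (trans (cong (λ p → carryOut (cutBlocks (drop (suc k) (lens n α)) (drop p (toBits n s)) (drop p (σ n α)))) (sum-take-suc (rs n α) i))
           (carry-below-block s))

  cOutOf≡ : ∀ s → cOutOf n α k s ≡ does (2 ^ L ≤? digit s + σᵢ + bit (carryIn s))
  cOutOf≡ s = trans (cong carryOut (drop-cutBlocks k (lens n α) (toBits n s) (σ n α)))
    (trans (cong (λ Ls → carryOut (cutBlocks Ls (drop P (toBits n s)) (drop P (σ n α)))) (drop-lookup (rs n α) i))
      (cong₃ (λ x y c → does (2 ^ L ≤? x + y + bit c))
        (trans (cong val (take-L-drop-P-toBits s)) (val-toBits L (s / 2 ^ R)))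
        (cong val take-L-drop-P-σ)
        (trans (cong₂ (λ x y → carryOut (cutBlocks (drop (suc k) (lens n α)) x y)) (drop-drop P L (toBits n s)) (drop-drop P L (σ n α)))
               (carry-below-block s))))

  Xof≡ : ∀ s → Xof n α k s ≡ weight L (digit s)
  Xof≡ s = cong wt (trans (piece≡take-L-drop-P (toBits n s)) (trans (take-L-drop-P-toBits s) (toBits-% L (s / 2 ^ R))))

  Yof≡ : ∀ s → Yof n α k s ≡ weight L (digit s + σᵢ + bit (carryIn s))
  Yof≡ s = begin
    wt (piece n α k (toBits n ((s + α) % 2 ^ n)))        ≡⟨ cong (λ bs → wt (piece n α k bs)) (toBits-% n (s + α)) ⟨
    wt (piece n α k (toBits n (s + α)))                  ≡⟨ cong wt (trans (piece≡take-L-drop-P _) (take-L-drop-P-toBits (s + α))) ⟩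
    weight L ((s + α) / 2 ^ R)                           ≡⟨ cong (weight L) ([m+n]/d≡m/d+n/d+carry (2 ^ R) s α) ⟩
    weight L (s / 2 ^ R + α / 2 ^ R + bit (carryIn s))
      ≡⟨ cong wt (toBits-cong L _ _ (trans ([m+n+o]%d≡[m%d+n%d+o]%d (2 ^ L) (s / 2 ^ R) (α / 2 ^ R) _)
                                   (cong (λ y → (digit s + y + bit (carryIn s)) % 2 ^ L) digit-α≡σᵢ))) ⟩
    weight L (digit s + σᵢ + bit (carryIn s))            ∎
    where open ≡-Reasoning

  private
    carryFrom : ℕ → Bool
    carryFrom r = does (2 ^ R ≤? r + α % 2 ^ R)

    #carry : Bool → ℕ
    #carry e = ∑ (2 ^ R) (λ r → if does (carryFrom r ≟ᵇ e) then 1 else 0)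

    carryOutIf : Bool → ℕ → Bool
    carryOutIf e s = does (does (2 ^ L ≤? digit s + σᵢ + bit e) ≟ᵇ a)

  select : Bool → ℕ → Bool
  select e s = does (carryIn s ≟ᵇ e) ∧ carryOutIf e s

  sample : Bool → List ℕ
  sample e = filterᵇ (select e) (upTo (2 ^ n))

  trivToNontriv≡sample : trivToNontriv n α k a ≡ sample a
  trivToNontriv≡sample = filterᵇ-cong (λ s →
    trans (cong₂ (λ c d → does (c ≟ᵇ a) ∧ does (d ≟ᵇ a)) (cInOf≡carryIn s) (cOutOf≡ s))
          (≟ᵇ-∧-subst (carryIn s) a (λ e → carryOutIf e s))) (upTo (2 ^ n))

  nontrivToNontriv≡sample : nontrivToNontriv n α k a ≡ sample (not a)
  nontrivToNontriv≡sample = filterᵇ-cong (λ s →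
    trans (cong₂ (λ c d → not (does (c ≟ᵇ a)) ∧ does (d ≟ᵇ a)) (cInOf≡carryIn s) (cOutOf≡ s))
          (trans (cong (_∧ carryOutIf (carryIn s) s) (not-≟ᵇ (carryIn s) a))
                 (≟ᵇ-∧-subst (carryIn s) (not a) (λ e → carryOutIf e s)))) (upTo (2 ^ n))

  2^n≡2^P*2^L*2^R : 2 ^ n ≡ 2 ^ P * 2 ^ L * 2 ^ R
  2^n≡2^P*2^L*2^R = trans (cong (2 ^_) n≡P+L+R) (trans (^-distribˡ-+-* 2 (P + L) R) (cong (_* 2 ^ R) (^-distribˡ-+-* 2 P L)))

  sum-select : ∀ e (F : ℕ → ℕ) g → (∀ s → F s ≡ g (Xof n α k s) (Yof n α k s)) →
    sum (map (λ s → if select e s then F s else 0) (upTo (2 ^ n))) ≡ 2 ^ P * #carry e * ∑ (2 ^ L) (blockTerm L a e g)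
  sum-select e F g F≡g = begin
    sum (map (λ s → if select e s then F s else 0) (upTo (2 ^ n)))   ≡⟨ sum-map-upTo _ (2 ^ n) ⟩
    ∑ (2 ^ n) (λ s → if select e s then F s else 0)                  ≡⟨ cong (λ N → ∑ N (λ s → if select e s then F s else 0)) 2^n≡2^P*2^L*2^R ⟩
    ∑ (2 ^ P * 2 ^ L * 2 ^ R) (λ s → if select e s then F s else 0)  ≡⟨ ∑-by-digits (2 ^ P) (2 ^ L) (2 ^ R) _ φ by-digits ⟩
    2 ^ P * ∑ (2 ^ L) (λ u → ∑ (2 ^ R) (φ u))                        ≡⟨ cong (2 ^ P *_) (∑-cong (2 ^ L) (λ u → ∑-indicator (2 ^ R) _ (blockTerm L a e g u))) ⟩
    2 ^ P * ∑ (2 ^ L) (λ u → #carry e * blockTerm L a e g u)         ≡⟨ cong (2 ^ P *_) (∑-*ˡ (2 ^ L) (#carry e) _) ⟩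
    2 ^ P * (#carry e * ∑ (2 ^ L) (blockTerm L a e g))               ≡⟨ *-assoc (2 ^ P) (#carry e) _ ⟨
    2 ^ P * #carry e * ∑ (2 ^ L) (blockTerm L a e g)                 ∎
    where
    open ≡-Reasoning
    φ : ℕ → ℕ → ℕ
    φ u r = if does (carryFrom r ≟ᵇ e) then blockTerm L a e g u else 0
    by-digits : ∀ s → (if select e s then F s else 0) ≡ φ (digit s) (s % 2 ^ R)
    by-digits s = begin
      (if select e s then F s else 0)                                                ≡⟨ if-∧ (does (carryIn s ≟ᵇ e)) (carryOutIf e s) (F s) ⟩
      (if does (carryIn s ≟ᵇ e) then (if carryOutIf e s then F s else 0) else 0)
        ≡⟨ cong (λ x → if does (carryIn s ≟ᵇ e) then (if carryOutIf e s then x else 0) else 0)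
                (trans (F≡g s) (cong₂ g (Xof≡ s) (Yof≡ s))) ⟩
      (if does (carryIn s ≟ᵇ e) then T (carryIn s) else 0)                         ≡⟨ if-≟ᵇ-subst (carryIn s) e T ⟩
      φ (digit s) (s % 2 ^ R)                                                        ∎
      where
      T : Bool → ℕ
      T c = if carryOutIf e s then g (weight L (digit s)) (weight L (digit s + σᵢ + bit c)) else 0

  mean-sample : ∀ e (F : ℕ → ℕ) g D .{{_ : NonZero D}} → sample e ≢ [] → ∑ (2 ^ L) (blockTerm L a e (λ _ _ → 1)) ≡ D →
    (∀ s → F s ≡ g (Xof n α k s) (Yof n α k s)) → mean (map F (sample e)) ≡ (ℤ.+ ∑ (2 ^ L) (blockTerm L a e g)) ÷ℚ D
  mean-sample e F g D sample≢[] #sample≡D F≡g = mean-≡ (map F (sample e)) (2 ^ P * #carry e) _ D (map≢[] sample≢[])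
    (trans (sum-filterᵇ (select e) F (upTo (2 ^ n))) (sum-select e F g F≡g))
    (trans (length-map F (sample e)) (trans (length-filterᵇ (select e) (upTo (2 ^ n)))
      (trans (sum-select e (λ _ → 1) (λ _ _ → 1) (λ _ → refl)) (cong (2 ^ P * #carry e *_) #sample≡D))))
    where
    map≢[] : ∀ {xs : List ℕ} → xs ≢ [] → map F xs ≢ []
    map≢[] {[]}    xs≢[] = xs≢[]
    map≢[] {_ ∷ _} _     ()

  XY≡coord : ∀ j s → XY n α k j s ≡ coord j (Xof n α k s) (Yof n α k s)
  XY≡coord Fin.zero    s = refl
  XY≡coord (Fin.suc _) s = refl

  covMatrix-sample : ∀ e D .{{_ : NonZero D}} → sample e ≢ [] → ∑ (2 ^ L) (blockTerm L a e (λ _ _ → 1)) ≡ D →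
    ∀ j l → covMatrix n α k (sample e) j l ≡ covOfSums D (λ g → ∑ (2 ^ L) (blockTerm L a e g)) j l
  covMatrix-sample e D sample≢[] #sample≡D j l = cong₃ (λ x y z → x -ℚ y *ℚ z)
    (mean-sample e _ (λ x y → coord j x y * coord l x y) D sample≢[] #sample≡D (λ s → cong₂ _*_ (XY≡coord j s) (XY≡coord l s)))
    (mean-sample e _ (coord j) D sample≢[] #sample≡D (XY≡coord j))
    (mean-sample e _ (coord l) D sample≢[] #sample≡D (XY≡coord l))

-- The covariance matrices

module _ (L : ℕ) where
  private instance _ = 2^-nonZero L

  var-diagonal : (ℤ.+ ∑w² L) ÷ℚ 2 ^ L -ℚ ((ℤ.+ ∑w L) ÷ℚ 2 ^ L) *ℚ ((ℤ.+ ∑w L) ÷ℚ 2 ^ L) ≡ (ℤ.+ L) ÷ℚ 4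
  var-diagonal = begin
    (ℤ.+ ∑w² L) ÷ℚ 2 ^ L -ℚ ((ℤ.+ ∑w L) ÷ℚ 2 ^ L) *ℚ ((ℤ.+ ∑w L) ÷ℚ 2 ^ L)
      ≡⟨ cong₂ (λ x y → x -ℚ y *ℚ y) (÷-cross (∑w² L) (L * (L + 1)) (2 ^ L) 4 (trans (*-comm (∑w² L) 4) (4*∑w²≡L*[L+1]*2^L L)))
                                     (÷-cross (∑w L) L (2 ^ L) 2 (trans (*-comm (∑w L) 2) (2*∑w≡L*2^L L))) ⟩
    (ℤ.+ (L * (L + 1))) ÷ℚ 4 -ℚ ((ℤ.+ L) ÷ℚ 2) *ℚ ((ℤ.+ L) ÷ℚ 2)
      ≡⟨ cong₂ (λ x y → x -ℚ y *ℚ y) (trans (÷≡ι*1/ℕ (L * (L + 1)) 4) (cong (_*ℚ ¼) (trans (ι-* L (L + 1)) (cong (ι L *ℚ_) (ι-+ L 1)))))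
                                     (÷≡ι*1/ℕ L 2) ⟩
    ι L *ℚ (ι L +ℚ 1ℚ) *ℚ ¼ -ℚ (ι L *ℚ ½) *ℚ (ι L *ℚ ½)   ≡⟨ identity (ι L) ⟩
    ι L *ℚ ¼                                             ≡⟨ ÷≡ι*1/ℕ L 4 ⟨
    (ℤ.+ L) ÷ℚ 4                                         ∎
    where
    open ≡-Reasoning
    identity : ∀ l → l *ℚ (l +ℚ 1ℚ) *ℚ ¼ -ℚ (l *ℚ ½) *ℚ (l *ℚ ½) ≡ l *ℚ ¼
    identity = solve 1 (λ l → l :* (l :+ con 1ℚ) :* con ¼ :- (l :* con ½) :* (l :* con ½) := l :* con ¼) refl
      where open ℚ-Solver

cov-diagonal : ∀ L j l → covOfSums (2 ^ L) {{2^-nonZero L}} (diagonalSums L) j l ≡ matA L j l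
cov-diagonal L Fin.zero    Fin.zero    = var-diagonal L
cov-diagonal L Fin.zero    (Fin.suc _) = var-diagonal L
cov-diagonal L (Fin.suc _) Fin.zero    = var-diagonal L
cov-diagonal L (Fin.suc _) (Fin.suc _) = var-diagonal L

module _ (L : ℕ) (1≤L : 1 ≤ L) where
  private
    instance _ = 2^L∸1-nonZero 1≤L
    m = 2 ^ L ∸ 1
    l = ι L
    I = 1/ℕ m
    q = 1ℚ +ℚ I

    *ℚ-distribʳ--ℚ : ∀ x y z → (x -ℚ y) *ℚ z ≡ x *ℚ z -ℚ y *ℚ z
    *ℚ-distribʳ--ℚ = solve 3 (λ x y z → (x :- y) :* z := x :* z :- y :* z) refl
      where open ℚ-Solver

    E[Y] : ∀ y → y ≡ ∑w L → ι y *ℚ I ≡ l *ℚ ½ *ℚ q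
    E[Y] y y≡ = ι-scale 2 y L m (trans (cong (2 *_) y≡) (trans (2*∑w≡L*2^L L) (cong (L *_) (2^L≡1+[2^L-1] L))))

    E[X] : ∀ x → x + L ≡ ∑w L → ι x *ℚ I ≡ l *ℚ ½ *ℚ q -ℚ l *ℚ I
    E[X] x x+L≡ = begin
      ι x *ℚ I                        ≡⟨ cong (_*ℚ I) (ι-∸ x L (∑w L) x+L≡) ⟩
      (ι (∑w L) -ℚ l) *ℚ I            ≡⟨ *ℚ-distribʳ--ℚ (ι (∑w L)) l I ⟩
      ι (∑w L) *ℚ I -ℚ l *ℚ I         ≡⟨ cong (_-ℚ l *ℚ I) (E[Y] (∑w L) refl) ⟩
      l *ℚ ½ *ℚ q -ℚ l *ℚ I           ∎
      where open ≡-Reasoning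

    E[YY] : ∀ y → y ≡ ∑w² L → ι y *ℚ I ≡ l *ℚ (l +ℚ 1ℚ) *ℚ ¼ *ℚ q
    E[YY] y y≡ = trans
      (ι-scale 4 y (L * (L + 1)) m (trans (cong (4 *_) y≡) (trans (4*∑w²≡L*[L+1]*2^L L) (cong (L * (L + 1) *_) (2^L≡1+[2^L-1] L)))))
      (cong (λ z → z *ℚ ¼ *ℚ q) (trans (ι-* L (L + 1)) (cong (l *ℚ_) (ι-+ L 1))))

    E[XX] : ∀ x → x + L * L ≡ ∑w² L → ι x *ℚ I ≡ l *ℚ (l +ℚ 1ℚ) *ℚ ¼ *ℚ q -ℚ l *ℚ l *ℚ I
    E[XX] x x+LL≡ = begin
      ι x *ℚ I                                ≡⟨ cong (_*ℚ I) (ι-∸ x (L * L) (∑w² L) x+LL≡) ⟩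
      (ι (∑w² L) -ℚ ι (L * L)) *ℚ I           ≡⟨ *ℚ-distribʳ--ℚ (ι (∑w² L)) (ι (L * L)) I ⟩
      ι (∑w² L) *ℚ I -ℚ ι (L * L) *ℚ I        ≡⟨ cong₂ _-ℚ_ (E[YY] (∑w² L) refl) (cong (_*ℚ I) (ι-* L L)) ⟩
      l *ℚ (l +ℚ 1ℚ) *ℚ ¼ *ℚ q -ℚ l *ℚ l *ℚ I ∎
      where open ≡-Reasoning

    E[XY] : ∀ z → z ≡ ∑ww⁺ L → ι z *ℚ I ≡ (l *ℚ l +ℚ l) *ℚ ¼ *ℚ q -ℚ 1ℚ
    E[XY] z z≡ = begin
      ι z *ℚ I                               ≡⟨ cong (λ u → ι u *ℚ I) z≡ ⟩
      ι (∑ww⁺ L) *ℚ I                        ≡⟨ cong (_*ℚ I) (ι-∸ (∑ww⁺ L) m _ refl) ⟩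
      (ι (∑ww⁺ L + m) -ℚ ι m) *ℚ I            ≡⟨ *ℚ-distribʳ--ℚ (ι (∑ww⁺ L + m)) (ι m) I ⟩
      ι (∑ww⁺ L + m) *ℚ I -ℚ ι m *ℚ I         ≡⟨ cong₂ _-ℚ_ (ι-scale 4 (∑ww⁺ L + m) (L * L + L) m (4*[∑ww⁺+m]≡[L*L+L]*[1+m] L))
                                                              (ι*1/ℕ≡1 m) ⟩
      ι (L * L + L) *ℚ ¼ *ℚ q -ℚ 1ℚ           ≡⟨ cong (λ z → z *ℚ ¼ *ℚ q -ℚ 1ℚ) (trans (ι-+ (L * L) L) (cong (_+ℚ l) (ι-* L L))) ⟩
      (l *ℚ l +ℚ l) *ℚ ¼ *ℚ q -ℚ 1ℚ           ∎
      where open ≡-Reasoning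

    fractions≡ : ∀ (C : ℚ → ℚ → ℚ) → C ((ℤ.+ L) ÷ℚ 4) ((ℤ.+ (L * L)) ÷ℚ 4) ≡ C (l *ℚ ¼) (l *ℚ l *ℚ ¼)
    fractions≡ C = cong₂ C (÷≡ι*1/ℕ L 4) (trans (÷≡ι*1/ℕ (L * L) 4) (cong (_*ℚ ¼) (ι-* L L)))

    cConst≡ : cConst L ≡ l *ℚ ¼ *ℚ q -ℚ l *ℚ l *ℚ ¼ *ℚ q *ℚ I
    cConst≡ = trans (cong (λ i → (ℤ.+ L ÷ℚ 4) *ℚ (1ℚ +ℚ i) -ℚ (ℤ.+ (L * L) ÷ℚ 4) *ℚ (1ℚ +ℚ i) *ℚ i) (inv2^L-1≡1/ℕ 1≤L))
                    (fractions≡ (λ u v → u *ℚ q -ℚ v *ℚ q *ℚ I))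

    dConst≡ : dConst L ≡ l *ℚ ¼ *ℚ q +ℚ l *ℚ l *ℚ ¼ *ℚ q *ℚ I -ℚ 1ℚ
    dConst≡ = trans (cong (λ i → (ℤ.+ L ÷ℚ 4) *ℚ (1ℚ +ℚ i) +ℚ (ℤ.+ (L * L) ÷ℚ 4) *ℚ (1ℚ +ℚ i) *ℚ i -ℚ 1ℚ) (inv2^L-1≡1/ℕ 1≤L))
                    (fractions≡ (λ u v → u *ℚ q +ℚ v *ℚ q *ℚ I -ℚ 1ℚ))

    covOfSums-ι : ∀ Z j l′ → covOfSums m Z j l′
                           ≡ ι (Z (λ x y → coord j x y * coord l′ x y)) *ℚ I -ℚ (ι (Z (coord j)) *ℚ I) *ℚ (ι (Z (coord l′)) *ℚ I)
    covOfSums-ι Z j l′ = cong₃ (λ u v w → u -ℚ v *ℚ w)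
      (÷≡ι*1/ℕ (Z (λ x y → coord j x y * coord l′ x y)) m) (÷≡ι*1/ℕ (Z (coord j)) m) (÷≡ι*1/ℕ (Z (coord l′)) m)

    open ℚ-Solver

    var-X : ∀ l I → let q = 1ℚ +ℚ I in
      (l *ℚ (l +ℚ 1ℚ) *ℚ ¼ *ℚ q -ℚ l *ℚ l *ℚ I) -ℚ (l *ℚ ½ *ℚ q -ℚ l *ℚ I) *ℚ (l *ℚ ½ *ℚ q -ℚ l *ℚ I)
        ≡ l *ℚ ¼ *ℚ q -ℚ l *ℚ l *ℚ ¼ *ℚ q *ℚ I
    var-X = solve 2 (λ l I → let q = con 1ℚ :+ I in
      (l :* (l :+ con 1ℚ) :* con ¼ :* q :- l :* l :* I) :- (l :* con ½ :* q :- l :* I) :* (l :* con ½ :* q :- l :* I)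
        := l :* con ¼ :* q :- l :* l :* con ¼ :* q :* I) refl

    var-Y : ∀ l I → let q = 1ℚ +ℚ I in
      l *ℚ (l +ℚ 1ℚ) *ℚ ¼ *ℚ q -ℚ (l *ℚ ½ *ℚ q) *ℚ (l *ℚ ½ *ℚ q)
        ≡ l *ℚ ¼ *ℚ q -ℚ l *ℚ l *ℚ ¼ *ℚ q *ℚ I
    var-Y = solve 2 (λ l I → let q = con 1ℚ :+ I in
      l :* (l :+ con 1ℚ) :* con ¼ :* q :- (l :* con ½ :* q) :* (l :* con ½ :* q)
        := l :* con ¼ :* q :- l :* l :* con ¼ :* q :* I) refl

    cov-XY : ∀ l I → let q = 1ℚ +ℚ I in
      ((l *ℚ l +ℚ l) *ℚ ¼ *ℚ q -ℚ 1ℚ) -ℚ (l *ℚ ½ *ℚ q -ℚ l *ℚ I) *ℚ (l *ℚ ½ *ℚ q)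
        ≡ l *ℚ ¼ *ℚ q +ℚ l *ℚ l *ℚ ¼ *ℚ q *ℚ I -ℚ 1ℚ
    cov-XY = solve 2 (λ l I → let q = con 1ℚ :+ I in
      ((l :* l :+ l) :* con ¼ :* q :- con 1ℚ) :- (l :* con ½ :* q :- l :* I) :* (l :* con ½ :* q)
        := l :* con ¼ :* q :+ l :* l :* con ¼ :* q :* I :- con 1ℚ) refl

    cov-YX : ∀ l I → let q = 1ℚ +ℚ I in
      ((l *ℚ l +ℚ l) *ℚ ¼ *ℚ q -ℚ 1ℚ) -ℚ (l *ℚ ½ *ℚ q) *ℚ (l *ℚ ½ *ℚ q -ℚ l *ℚ I)
        ≡ l *ℚ ¼ *ℚ q +ℚ l *ℚ l *ℚ ¼ *ℚ q *ℚ I -ℚ 1ℚ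
    cov-YX = solve 2 (λ l I → let q = con 1ℚ :+ I in
      ((l :* l :+ l) :* con ¼ :* q :- con 1ℚ) :- (l :* con ½ :* q) :* (l :* con ½ :* q :- l :* I)
        := l :* con ¼ :* q :+ l :* l :* con ¼ :* q :* I :- con 1ℚ) refl

    ∑X+L≡ : ∑ m (weight L) + L ≡ ∑w L
    ∑X+L≡ = ∑-weight-init L (λ x → x)
    ∑XX+LL≡ : ∑ m (λ v → weight L v * weight L v) + L * L ≡ ∑w² L
    ∑XX+LL≡ = ∑-weight-init L (λ x → x * x)
    ∑Y≡ : ∑ m (weight L ∘ suc) ≡ ∑w L
    ∑Y≡ = ∑-weight-tail L (λ x → x)
    ∑YY≡ : ∑ m (λ v → weight L (suc v) * weight L (suc v)) ≡ ∑w² L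
    ∑YY≡ = ∑-weight-tail L (λ x → x * x)
    ∑YX≡ : ∑ m (λ v → weight L (suc v) * weight L v) ≡ ∑ww⁺ L
    ∑YX≡ = ∑-cong m (λ v → *-comm (weight L (suc v)) (weight L v))

  cov-shift : ∀ j l′ → covOfSums m (shiftSums L) j l′ ≡ matB L j l′
  cov-shift Fin.zero Fin.zero = trans (covOfSums-ι (shiftSums L) Fin.zero Fin.zero)
    (trans (cong₂ (λ u v → u -ℚ v *ℚ v) (E[XX] _ ∑XX+LL≡) (E[X] _ ∑X+L≡)) (trans (var-X l I) (sym cConst≡)))
  cov-shift Fin.zero (Fin.suc _) = trans (covOfSums-ι (shiftSums L) Fin.zero (Fin.suc Fin.zero))
    (trans (cong₃ (λ u v w → u -ℚ v *ℚ w) (E[XY] _ refl) (E[X] _ ∑X+L≡) (E[Y] _ ∑Y≡)) (trans (cov-XY l I) (sym dConst≡)))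
  cov-shift (Fin.suc _) Fin.zero = trans (covOfSums-ι (shiftSums L) (Fin.suc Fin.zero) Fin.zero)
    (trans (cong₃ (λ u v w → u -ℚ v *ℚ w) (E[XY] _ ∑YX≡) (E[Y] _ ∑Y≡) (E[X] _ ∑X+L≡)) (trans (cov-YX l I) (sym dConst≡)))
  cov-shift (Fin.suc _) (Fin.suc _) = trans (covOfSums-ι (shiftSums L) (Fin.suc Fin.zero) (Fin.suc Fin.zero))
    (trans (cong₂ (λ u v → u -ℚ v *ℚ v) (E[YY] _ ∑YY≡) (E[Y] _ ∑Y≡)) (trans (var-Y l I) (sym cConst≡)))

  cov-shift-flipped : ∀ j l′ → covOfSums m (λ g → shiftSums L (λ x y → g y x)) j l′ ≡ matB L j l′
  cov-shift-flipped Fin.zero    Fin.zero    = cov-shift (Fin.suc Fin.zero) (Fin.suc Fin.zero)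
  cov-shift-flipped Fin.zero    (Fin.suc _) = cov-shift (Fin.suc Fin.zero) Fin.zero
  cov-shift-flipped (Fin.suc _) Fin.zero    = cov-shift Fin.zero (Fin.suc Fin.zero)
  cov-shift-flipped (Fin.suc _) (Fin.suc _) = cov-shift Fin.zero Fin.zero

module _ (L : ℕ) (1≤L : 1 ≤ L) where
  private instance _ = 2^L∸1-nonZero 1≤L

  ∑-blockTerm-nontrivial-count : ∀ a → ∑ (2 ^ L) (blockTerm L a (not a) (λ _ _ → 1)) ≡ 2 ^ L ∸ 1
  ∑-blockTerm-nontrivial-count false = trans (∑-blockTerm-nontrivial-false L _) (∑-count (2 ^ L ∸ 1))
  ∑-blockTerm-nontrivial-count true  = trans (∑-blockTerm-nontrivial-true L _) (∑-count (2 ^ L ∸ 1))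

  cov-nontrivial : ∀ a j l → covOfSums (2 ^ L ∸ 1) (λ g → ∑ (2 ^ L) (blockTerm L a (not a) g)) j l ≡ matB L j l
  cov-nontrivial false j l = trans (covOfSums-cong (2 ^ L ∸ 1) (∑-blockTerm-nontrivial-false L) j l) (cov-shift L 1≤L j l)
  cov-nontrivial true  j l = trans (covOfSums-cong (2 ^ L ∸ 1) (∑-blockTerm-nontrivial-true L) j l) (cov-shift-flipped L 1≤L j l)

lemma3 : (n : ℕ) → 1 ≤ n → (α : ℕ) → α < 2 ^ n →
           (i : Fin (length (rs n α))) →
           ((trivToNontriv n α (toℕ i) (proj₁ (lookup (rs n α) i)) ≢ []) →
              ∀ j l → covMatrix n α (toℕ i) (trivToNontriv n α (toℕ i) (proj₁ (lookup (rs n α) i))) j l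
                      ≡ matA (proj₂ (lookup (rs n α) i)) j l)
           ×
           ((nontrivToNontriv n α (toℕ i) (proj₁ (lookup (rs n α) i)) ≢ []) →
              ∀ j l → covMatrix n α (toℕ i) (nontrivToNontriv n α (toℕ i) (proj₁ (lookup (rs n α) i))) j l
                      ≡ matB (proj₂ (lookup (rs n α) i)) j l)
lemma3 n _ α _ i = trivial , nontrivial
  where
  open Block n α i
  instance
    _ = 2^-nonZero L
    _ = 2^L∸1-nonZero 1≤L
  open ≡-Reasoning

  trivial : trivToNontriv n α k a ≢ [] → ∀ j l → covMatrix n α k (trivToNontriv n α k a) j l ≡ matA L j l
  trivial ≢[] j l = begin
    covMatrix n α k (trivToNontriv n α k a) j l                  ≡⟨ cong (λ xs → covMatrix n α k xs j l) trivToNontriv≡sample ⟩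
    covMatrix n α k (sample a) j l                               ≡⟨ covMatrix-sample a (2 ^ L) (≢[] ∘ trans trivToNontriv≡sample)
                                                                      (trans (∑-blockTerm-trivial L _ a) (∑-count (2 ^ L))) j l ⟩
    covOfSums (2 ^ L) (λ g → ∑ (2 ^ L) (blockTerm L a a g)) j l    ≡⟨ covOfSums-cong (2 ^ L) (λ g → ∑-blockTerm-trivial L g a) j l ⟩
    covOfSums (2 ^ L) (diagonalSums L) j l                         ≡⟨ cov-diagonal L j l ⟩
    matA L j l                                                   ∎

  nontrivial : nontrivToNontriv n α k a ≢ [] → ∀ j l → covMatrix n α k (nontrivToNontriv n α k a) j l ≡ matB L j l
  nontrivial ≢[] j l = begin
    covMatrix n α k (nontrivToNontriv n α k a) j l               ≡⟨ cong (λ xs → covMatrix n α k xs j l) nontrivToNontriv≡sample ⟩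
    covMatrix n α k (sample (not a)) j l                         ≡⟨ covMatrix-sample (not a) (2 ^ L ∸ 1) (≢[] ∘ trans nontrivToNontriv≡sample)
                                                                      (∑-blockTerm-nontrivial-count L 1≤L a) j l ⟩
    covOfSums (2 ^ L ∸ 1) (λ g → ∑ (2 ^ L) (blockTerm L a (not a) g)) j l ≡⟨ cov-nontrivial L 1≤L a j l ⟩
    matB L j l                                                   ∎
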